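{- Let $\mathbf{L}$ be one of the logics described in the context. The substitution rules $[y/x]$: from $\Gamma\Rightarrow\Delta$ infer $\Gamma[y/x]\Rightarrow\Delta[y/x]$ (where $y$ is free for $x$ in each formula occurring in $\Gamma,\Delta$), and $[w/v]$: from $\Gamma\Rightarrow\Delta$ infer $\Gamma[w/v]\Rightarrow\Delta[w/v]$ (replacing label $v$ by label $w$), are height-preserving admissible in $\mathbf{G3Q\lambda.L}$: if the premiss is derivable with height at most $n$, so is the conclusion.
   Context: Language $\mathcal{L}^\lambda$: fix a signature of $n$-ary predicate letters and an infinite set of variables $x,y,z,\dots$. Terms and formulas are defined simultaneously: terms $t::=x\mid \iota xA$ (definite descriptions), formulas $A::=Px_1\dots x_n\mid x_1=x_2\mid\bot\mid A\wedge A\mid A\vee A\mid A\supset A\mid\forall xA\mid\exists xA\mid\Box A\mid\Diamond A\mid \lambda xA.t$. $\iota x$ binds $x$ in $A$; in $\lambda xA.t$ the occurrences of $x$ in $A$ are bound by $\lambda x$ (the displayed $t$ is not in its scope). $A[y/x]$ replaces free occurrences of $x$ by $y$, with $y$ free for $x$. Atomic formulas are $Px_1\dots x_n$ and $x_1=x_2$. Labelled sequents. Labels $w,v,u,\dots$ form a separate set. Expressions: labelled formulas $w:A$, domain atoms $x\in w$, relational atoms $w\mathscr{R}v$, denotation formulas $D(t,x,w)$ ($t$ a term, $x$ a variable). A sequent $\Gamma\Rightarrow\Delta$ has $\Gamma$ a multiset of labelled formulas, denotation formulas, domain atoms and relational atoms, and $\Delta$ a multiset of labelled formulas and denotation formulas.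 Substitutions $[y/x]$ (free occurrences of a variable) and $[w/v]$ (all occurrences of a label) extend componentwise to these expressions and to sequents. "Fresh" means not occurring in the conclusion of the rule. Calculus $\mathbf{G3Q\lambda.K}$. Initial sequents: $w:p,\Gamma\Rightarrow\Delta,w:p$ ($p$ atomic); $D(y,x,w),\Gamma\Rightarrow\Delta,D(y,x,w)$ ($y$ a variable); $w:\bot,\Gamma\Rightarrow\Delta$. Propositional rules (at one label $w$): $L\wedge$: from $w:A,w:B,\Gamma\Rightarrow\Delta$ infer $w:A\wedge B,\Gamma\Rightarrow\Delta$; $R\wedge$: from $\Gamma\Rightarrow\Delta,w:A$ and $\Gamma\Rightarrow\Delta,w:B$ infer $\Gamma\Rightarrow\Delta,w:A\wedge B$; $L\vee$: from $w:A,\Gamma\Rightarrow\Delta$ and $w:B,\Gamma\Rightarrow\Delta$ infer $w:A\vee B,\Gamma\Rightarrow\Delta$; $R\vee$: from $\Gamma\Rightarrow\Delta,w:A,w:B$ infer $\Gamma\Rightarrow\Delta,w:A\vee B$; $L\supset$: from $\Gamma\Rightarrow\Delta,w:A$ and $w:B,\Gamma\Rightarrow\Delta$ infer $w:A\supset B,\Gamma\Rightarrow\Delta$; $R\supset$: from $w:A,\Gamma\Rightarrow\Delta,w:B$ infer $\Gamma\Rightarrow\Delta,w:A\supset B$. Quantifiers: $L\forall$: from $w:A[y/x],y\in w,w:\forall xA,\Gamma\Rightarrow\Delta$ infer $y\in w,w:\forall xA,\Gamma\Rightarrow\Delta$; $R\forall$ ($z$ fresh): from $z\in w,\Gamma\Rightarrow\Delta,w:A[z/x]$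 infer $\Gamma\Rightarrow\Delta,w:\forall xA$; $L\exists$ ($z$ fresh): from $z\in w,w:A[z/x],\Gamma\Rightarrow\Delta$ infer $w:\exists xA,\Gamma\Rightarrow\Delta$; $R\exists$: from $y\in w,\Gamma\Rightarrow\Delta,w:\exists xA,w:A[y/x]$ infer $y\in w,\Gamma\Rightarrow\Delta,w:\exists xA$. Modalities: $L\Box$: from $v:A,w\mathscr{R}v,w:\Box A,\Gamma\Rightarrow\Delta$ infer $w\mathscr{R}v,w:\Box A,\Gamma\Rightarrow\Delta$; $R\Box$ ($u$ fresh): from $w\mathscr{R}u,\Gamma\Rightarrow\Delta,u:A$ infer $\Gamma\Rightarrow\Delta,w:\Box A$; $L\Diamond$ ($u$ fresh): from $w\mathscr{R}u,u:A,\Gamma\Rightarrow\Delta$ infer $w:\Diamond A,\Gamma\Rightarrow\Delta$; $R\Diamond$: from $w\mathscr{R}v,\Gamma\Rightarrow\Delta,w:\Diamond A,v:A$ infer $w\mathscr{R}v,\Gamma\Rightarrow\Delta,w:\Diamond A$. Identity: $Ref_=$: from $w:x=x,\Gamma\Rightarrow\Delta$ infer $\Gamma\Rightarrow\Delta$; $RigVar$: from $v:y=z,w:y=z,\Gamma\Rightarrow\Delta$ infer $w:y=z,\Gamma\Rightarrow\Delta$; $Repl$: from $E[z/x],E[y/x],w:y=z,\Gamma\Rightarrow\Delta$ infer $E[y/x],w:y=z,\Gamma\Rightarrow\Delta$, where $E$ is a denotation formula with variable first argument and label $w$, a domain atom $x'\in w$, or a labelled atomic formula $w:p$. $\lambda$: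 $L\lambda$ ($z$ fresh): from $D(t,z,w),w:B[z/x],\Gamma\Rightarrow\Delta$ infer $w:\lambda xB.t,\Gamma\Rightarrow\Delta$; $R\lambda$: from $\Gamma\Rightarrow\Delta,w:\lambda xB.t,D(t,y,w)$ and $\Gamma\Rightarrow\Delta,w:\lambda xB.t,w:B[y/x]$ infer $\Gamma\Rightarrow\Delta,w:\lambda xB.t$. Denotation: $LD_1$: from $w:A[x_2/x_1],D(\iota x_1A,x_2,w),\Gamma\Rightarrow\Delta$ infer $D(\iota x_1A,x_2,w),\Gamma\Rightarrow\Delta$; $LD_2$: from $D(\iota x_1A,x_2,w),\Gamma\Rightarrow\Delta,w:A[y/x_1]$ and $w:x_2=y,D(\iota x_1A,x_2,w),\Gamma\Rightarrow\Delta$ infer $D(\iota x_1A,x_2,w),\Gamma\Rightarrow\Delta$; $RD$ ($z$ fresh): from $\Gamma\Rightarrow\Delta,w:A[x_2/x_1]$ and $w:A[z/x_1],\Gamma\Rightarrow\Delta,w:x_2=z$ infer $\Gamma\Rightarrow\Delta,D(\iota x_1A,x_2,w)$; $DenVar$: from $D(x,x,w),\Gamma\Rightarrow\Delta$ infer $\Gamma\Rightarrow\Delta$; $DenId$: from $w:y=x,D(y,x,w),\Gamma\Rightarrow\Delta$ infer $D(y,x,w),\Gamma\Rightarrow\Delta$ ($x,y$ variables). Non-logical rules: $Ref_\mathcal{W}$: from $w\mathscr{R}w,\Gamma\Rightarrow\Delta$ infer $\Gamma\Rightarrow\Delta$; $Ser$ ($u$ fresh): from $w\mathscr{R}u,\Gamma\Rightarrow\Delta$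 infer $\Gamma\Rightarrow\Delta$; $Trans$: from $w\mathscr{R}u,w\mathscr{R}v,v\mathscr{R}u,\Gamma\Rightarrow\Delta$ infer $w\mathscr{R}v,v\mathscr{R}u,\Gamma\Rightarrow\Delta$; $Eucl$: from $v\mathscr{R}u,w\mathscr{R}v,w\mathscr{R}u,\Gamma\Rightarrow\Delta$ infer $w\mathscr{R}v,w\mathscr{R}u,\Gamma\Rightarrow\Delta$, always together with $Eucl^c$: from $v\mathscr{R}v,w\mathscr{R}v,\Gamma\Rightarrow\Delta$ infer $w\mathscr{R}v,\Gamma\Rightarrow\Delta$; $Incr$: from $x\in v,x\in w,w\mathscr{R}v,\Gamma\Rightarrow\Delta$ infer $x\in w,w\mathscr{R}v,\Gamma\Rightarrow\Delta$; $Decr$: from $x\in w,x\in v,w\mathscr{R}v,\Gamma\Rightarrow\Delta$ infer $x\in v,w\mathscr{R}v,\Gamma\Rightarrow\Delta$; $Cons$: from $x\in w,\Gamma\Rightarrow\Delta$ infer $\Gamma\Rightarrow\Delta$. For any set $N$ of these non-logical rules, $\mathbf{G3Q\lambda.L}=\mathbf{G3Q\lambda.K}+N$. Derivations: trees of (pure: no variable both free and bound) sequents with initial sequents at the leaves, built by the rules; the height of a derivation is the number of nodes of its longest branch. $\Gamma\Rightarrow\Delta$ is derivable with height $n$ if it or an alphabetic variant has a derivation of height at most $n$. -}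

module Defs where

open import Data.Nat using (ℕ; _≡ᵇ_; _≟_)
open import Data.Bool using (Bool; true; false; if_then_else_; T)
open import Data.List using (List; []; _∷_; _++_; filter; map; concatMap)
open import Data.List.Membership.Propositional using (_∈_; _∉_)
open import Data.List.Relation.Binary.Permutation.Propositional using (_↭_)
open import Data.List.Relation.Binary.Pointwise using (Pointwise)
open import Data.List.Relation.Unary.All using (All)
open import Data.Vec using (Vec; toList)
import Data.Vec as Vec
import Data.Vec.Relation.Binary.Pointwise.Inductive as VP
open import Data.Product using (_×_; _,_; Σ)
open import Data.Sum using (_⊎_)
open import Data.Unit using (⊤)
open import Data.Empty using (⊥)
open import Relation.Nullary using (¬_; ¬?)
open import Relation.Binary.PropositionalEquality using (_≡_; _≢_)

record Signature : Set₁ where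
  field
    Pred  : Set
    arity : Pred → ℕ
open Signature public

Var : Set
Var = ℕ

Label : Set
Label = ℕ

module _ (S : Signature) where
  mutual
    data Term : Set where
      var : Var → Term
      ι   : Var → Formula → Term

    data Formula : Set where
      pred  : (P : Pred S) → Vec Var (arity S P) → Formula
      eq    : Var → Var → Formula
      ⊥'    : Formula
      _∧'_  : Formula → Formula → Formula
      _∨'_  : Formula → Formula → Formula
      _⊃'_  : Formula → Formula → Formula
      ∀'    : Var → Formula → Formula
      ∃'    : Var → Formula → Formula
      □'    : Formula → Formula
      ◇'    : Formula → Formula
      lam   : Var → Formula → Term → Formula

  data Expr : Set where
    lab : Label → Formula → Expr
    dom : Var → Label → Expr
    rel : Label → Label → Expr
    den : Term → Var → Label → Expr

  -- Γ ⇒ Δ ; multisets are represented by lists, taken up to permutation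
  infix 4 _⇒_
  data Seq : Set where
    _⇒_ : List Expr → List Expr → Seq


module _ {S : Signature} where

  data IsAtomic : Formula S → Set where
    at-pred : ∀ {P xs} → IsAtomic (pred P xs)
    at-eq   : ∀ {x y} → IsAtomic (eq x y)

  remove : Var → List Var → List Var
  remove x = filter (λ z → ¬? (z ≟ x))

  mutual
    FVT : Term S → List Var
    FVT (var x) = x ∷ []
    FVT (ι x A) = remove x (FVF A)

    FVF : Formula S → List Var
    FVF (pred P xs) = toList xs
    FVF (eq x y) = x ∷ y ∷ []
    FVF ⊥' = []
    FVF (A ∧' B) = FVF A ++ FVF B
    FVF (A ∨' B) = FVF A ++ FVF B
    FVF (A ⊃' B) = FVF A ++ FVF B
    FVF (∀' x A) = remove x (FVF A)
    FVF (∃' x A) = remove x (FVF A)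
    FVF (□' A) = FVF A
    FVF (◇' A) = FVF A
    FVF (lam x A t) = remove x (FVF A) ++ FVT t

  mutual
    BVT : Term S → List Var
    BVT (var x) = []
    BVT (ι x A) = x ∷ BVF A

    BVF : Formula S → List Var
    BVF (pred P xs) = []
    BVF (eq x y) = []
    BVF ⊥' = []
    BVF (A ∧' B) = BVF A ++ BVF B
    BVF (A ∨' B) = BVF A ++ BVF B
    BVF (A ⊃' B) = BVF A ++ BVF B
    BVF (∀' x A) = x ∷ BVF A
    BVF (∃' x A) = x ∷ BVF A
    BVF (□' A) = BVF A
    BVF (◇' A) = BVF A
    BVF (lam x A t) = x ∷ BVF A ++ BVT t

  FVE : Expr S → List Var
  FVE (lab w A) = FVF A
  FVE (dom x w) = x ∷ []
  FVE (rel w v) = []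
  FVE (den t x w) = FVT t ++ x ∷ []

  BVE : Expr S → List Var
  BVE (lab w A) = BVF A
  BVE (dom x w) = []
  BVE (rel w v) = []
  BVE (den t x w) = BVT t

  LabE : Expr S → List Label
  LabE (lab w A) = w ∷ []
  LabE (dom x w) = w ∷ []
  LabE (rel w v) = w ∷ v ∷ []
  LabE (den t x w) = w ∷ []

  FVs BVs Vars : Seq S → List Var
  FVs (Γ ⇒ Δ) = concatMap FVE Γ ++ concatMap FVE Δ
  BVs (Γ ⇒ Δ) = concatMap BVE Γ ++ concatMap BVE Δ
  -- every occurrence of a variable is free or bound (binders included)
  Vars s = FVs s ++ BVs s

  Labels : Seq S → List Label
  Labels (Γ ⇒ Δ) = concatMap LabE Γ ++ concatMap LabE Δ

  FreshVar : Var → Seq S → Set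
  FreshVar z s = z ∉ Vars s

  FreshLabel : Label → Seq S → Set
  FreshLabel u s = u ∉ Labels s

  Pure : Seq S → Set
  Pure s = ∀ x → x ∈ FVs s → x ∉ BVs s

  SuccOK : Expr S → Set
  SuccOK (lab w A) = ⊤
  SuccOK (dom x w) = ⊥
  SuccOK (rel w v) = ⊥
  SuccOK (den t x w) = ⊤

  GoodSeq : Seq S → Set
  GoodSeq s@(Γ ⇒ Δ) = Pure s × All SuccOK Δ

  -- substitution [y/x] of free occurrences of x by y (no renaming;
  -- used under the side condition "y free for x")

  sv : Var → Var → Var → Var
  sv y x z = if z ≡ᵇ x then y else z

  mutual
    subT : Var → Var → Term S → Term S
    subT y x (var z) = var (sv y x z)
    subT y x (ι z A) = if z ≡ᵇ x then ι z A else ι z (subF y x A)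

    subF : Var → Var → Formula S → Formula S
    subF y x (pred P xs) = pred P (Vec.map (sv y x) xs)
    subF y x (eq a b) = eq (sv y x a) (sv y x b)
    subF y x ⊥' = ⊥'
    subF y x (A ∧' B) = subF y x A ∧' subF y x B
    subF y x (A ∨' B) = subF y x A ∨' subF y x B
    subF y x (A ⊃' B) = subF y x A ⊃' subF y x B
    subF y x (∀' z A) = if z ≡ᵇ x then ∀' z A else ∀' z (subF y x A)
    subF y x (∃' z A) = if z ≡ᵇ x then ∃' z A else ∃' z (subF y x A)
    subF y x (□' A) = □' (subF y x A)
    subF y x (◇' A) = ◇' (subF y x A)
    subF y x (lam z A t) =
      lam z (if z ≡ᵇ x then A else subF y x A) (subT y x t)

  subE : Var → Var → Expr S → Expr S
  subE y x (lab w A) = lab w (subF y x A)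
  subE y x (dom z w) = dom (sv y x z) w
  subE y x (rel w v) = rel w v
  subE y x (den t z w) = den (subT y x t) (sv y x z) w

  sl : Label → Label → Label → Label
  sl w v u = if u ≡ᵇ v then w else u

  lsubE : Label → Label → Expr S → Expr S
  lsubE w v (lab u A) = lab (sl w v u) A
  lsubE w v (dom x u) = dom x (sl w v u)
  lsubE w v (rel u u') = rel (sl w v u) (sl w v u')
  lsubE w v (den t x u) = den t x (sl w v u)

  mutual
    FreeForT : Var → Var → Term S → Set
    FreeForT y x (var z) = ⊤
    FreeForT y x (ι z A) = (x ∉ remove z (FVF A)) ⊎ (z ≢ y × FreeForF y x A)

    FreeForF : Var → Var → Formula S → Set
    FreeForF y x (pred P xs) = ⊤
    FreeForF y x (eq a b) = ⊤
    FreeForF y x ⊥' = ⊤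
    FreeForF y x (A ∧' B) = FreeForF y x A × FreeForF y x B
    FreeForF y x (A ∨' B) = FreeForF y x A × FreeForF y x B
    FreeForF y x (A ⊃' B) = FreeForF y x A × FreeForF y x B
    FreeForF y x (∀' z A) = (x ∉ remove z (FVF A)) ⊎ (z ≢ y × FreeForF y x A)
    FreeForF y x (∃' z A) = (x ∉ remove z (FVF A)) ⊎ (z ≢ y × FreeForF y x A)
    FreeForF y x (□' A) = FreeForF y x A
    FreeForF y x (◇' A) = FreeForF y x A
    FreeForF y x (lam z A t) =
      ((x ∉ remove z (FVF A)) ⊎ (z ≢ y × FreeForF y x A)) × FreeForT y x t

  FreeForE : Var → Var → Expr S → Set
  FreeForE y x (lab w A) = FreeForF y x A
  FreeForE y x (dom z w) = ⊤
  FreeForE y x (rel w v) = ⊤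
  FreeForE y x (den t z w) = FreeForT y x t

  data _⊢_≈ᵛ_ : List (Var × Var) → Var → Var → Set where
    free  : ∀ {x} → [] ⊢ x ≈ᵛ x
    here  : ∀ {ρ x y} → ((x , y) ∷ ρ) ⊢ x ≈ᵛ y
    there : ∀ {ρ a b x y} → x ≢ a → y ≢ b → ρ ⊢ x ≈ᵛ y → ((a , b) ∷ ρ) ⊢ x ≈ᵛ y

  mutual
    data AlphaT (ρ : List (Var × Var)) : Term S → Term S → Set where
      var : ∀ {x y} → ρ ⊢ x ≈ᵛ y → AlphaT ρ (var x) (var y)
      ι   : ∀ {x y A B} → AlphaF ((x , y) ∷ ρ) A B → AlphaT ρ (ι x A) (ι y B)

    data AlphaF (ρ : List (Var × Var)) : Formula S → Formula S → Set where
      pred : ∀ {P xs ys} → VP.Pointwise (ρ ⊢_≈ᵛ_) xs ys → AlphaF ρ (pred P xs) (pred P ys)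
      eq   : ∀ {a b a' b'} → ρ ⊢ a ≈ᵛ a' → ρ ⊢ b ≈ᵛ b' → AlphaF ρ (eq a b) (eq a' b')
      ⊥'   : AlphaF ρ ⊥' ⊥'
      _∧'_ : ∀ {A B A' B'} → AlphaF ρ A A' → AlphaF ρ B B' → AlphaF ρ (A ∧' B) (A' ∧' B')
      _∨'_ : ∀ {A B A' B'} → AlphaF ρ A A' → AlphaF ρ B B' → AlphaF ρ (A ∨' B) (A' ∨' B')
      _⊃'_ : ∀ {A B A' B'} → AlphaF ρ A A' → AlphaF ρ B B' → AlphaF ρ (A ⊃' B) (A' ⊃' B')
      ∀'   : ∀ {x y A B} → AlphaF ((x , y) ∷ ρ) A B → AlphaF ρ (∀' x A) (∀' y B)
      ∃'   : ∀ {x y A B} → AlphaF ((x , y) ∷ ρ) A B → AlphaF ρ (∃' x A) (∃' y B)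
      □'   : ∀ {A B} → AlphaF ρ A B → AlphaF ρ (□' A) (□' B)
      ◇'   : ∀ {A B} → AlphaF ρ A B → AlphaF ρ (◇' A) (◇' B)
      lam  : ∀ {x y A B t u} → AlphaF ((x , y) ∷ ρ) A B → AlphaT ρ t u →
             AlphaF ρ (lam x A t) (lam y B u)

  data AlphaE : Expr S → Expr S → Set where
    lab : ∀ {w A B} → AlphaF [] A B → AlphaE (lab w A) (lab w B)
    dom : ∀ {x w} → AlphaE (dom x w) (dom x w)
    rel : ∀ {w v} → AlphaE (rel w v) (rel w v)
    den : ∀ {t u x w} → AlphaT [] t u → AlphaE (den t x w) (den u x w)

  AlphaVariant : Seq S → Seq S → Set
  AlphaVariant (Γ ⇒ Δ) (Γ' ⇒ Δ') = Pointwise AlphaE Γ Γ' × Pointwise AlphaE Δ Δ'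

  _≈ₛ_ : Seq S → Seq S → Set
  (Γ ⇒ Δ) ≈ₛ (Γ' ⇒ Δ') = (Γ ↭ Γ') × (Δ ↭ Δ')

-- Non-logical rules (Eucl always comes with Eucl^c)

data NL : Set where
  ref-W ser trans eucl incr decr cons : NL

module _ {S : Signature} where

  -- Rule N ps c : c follows from premisses ps by one rule of G3Qλ.K + N.
  -- Principal / active formulas are written at the front of the lists;
  -- derivations work up to permutation (multisets).
  data Rule (N : NL → Bool) : List (Seq S) → Seq S → Set where
    init-at : ∀ {w p Γ Δ} → IsAtomic p →
      Rule N [] (lab w p ∷ Γ ⇒ lab w p ∷ Δ)
    init-D  : ∀ {y x w Γ Δ} →
      Rule N [] (den (var y) x w ∷ Γ ⇒ den (var y) x w ∷ Δ)
    init-⊥  : ∀ {w Γ Δ} → Rule N [] (lab w ⊥' ∷ Γ ⇒ Δ)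
    L∧ : ∀ {w A B Γ Δ} →
      Rule N ((lab w A ∷ lab w B ∷ Γ ⇒ Δ) ∷ []) (lab w (A ∧' B) ∷ Γ ⇒ Δ)
    R∧ : ∀ {w A B Γ Δ} →
      Rule N ((Γ ⇒ lab w A ∷ Δ) ∷ (Γ ⇒ lab w B ∷ Δ) ∷ []) (Γ ⇒ lab w (A ∧' B) ∷ Δ)
    L∨ : ∀ {w A B Γ Δ} →
      Rule N ((lab w A ∷ Γ ⇒ Δ) ∷ (lab w B ∷ Γ ⇒ Δ) ∷ []) (lab w (A ∨' B) ∷ Γ ⇒ Δ)
    R∨ : ∀ {w A B Γ Δ} →
      Rule N ((Γ ⇒ lab w A ∷ lab w B ∷ Δ) ∷ []) (Γ ⇒ lab w (A ∨' B) ∷ Δ)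
    L⊃ : ∀ {w A B Γ Δ} →
      Rule N ((Γ ⇒ lab w A ∷ Δ) ∷ (lab w B ∷ Γ ⇒ Δ) ∷ []) (lab w (A ⊃' B) ∷ Γ ⇒ Δ)
    R⊃ : ∀ {w A B Γ Δ} →
      Rule N ((lab w A ∷ Γ ⇒ lab w B ∷ Δ) ∷ []) (Γ ⇒ lab w (A ⊃' B) ∷ Δ)
    L∀ : ∀ {w x y A Γ Δ} →
      Rule N ((lab w (subF y x A) ∷ dom y w ∷ lab w (∀' x A) ∷ Γ ⇒ Δ) ∷ [])
             (dom y w ∷ lab w (∀' x A) ∷ Γ ⇒ Δ)
    R∀ : ∀ {w x z A Γ Δ} → FreshVar z (Γ ⇒ lab w (∀' x A) ∷ Δ) →
      Rule N ((dom z w ∷ Γ ⇒ lab w (subF z x A) ∷ Δ) ∷ [])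
             (Γ ⇒ lab w (∀' x A) ∷ Δ)
    L∃ : ∀ {w x z A Γ Δ} → FreshVar z (lab w (∃' x A) ∷ Γ ⇒ Δ) →
      Rule N ((dom z w ∷ lab w (subF z x A) ∷ Γ ⇒ Δ) ∷ [])
             (lab w (∃' x A) ∷ Γ ⇒ Δ)
    R∃ : ∀ {w x y A Γ Δ} →
      Rule N ((dom y w ∷ Γ ⇒ lab w (∃' x A) ∷ lab w (subF y x A) ∷ Δ) ∷ [])
             (dom y w ∷ Γ ⇒ lab w (∃' x A) ∷ Δ)
    L□ : ∀ {w v A Γ Δ} →
      Rule N ((lab v A ∷ rel w v ∷ lab w (□' A) ∷ Γ ⇒ Δ) ∷ [])
             (rel w v ∷ lab w (□' A) ∷ Γ ⇒ Δ)
    R□ : ∀ {w u A Γ Δ} → FreshLabel u (Γ ⇒ lab w (□' A) ∷ Δ) →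
      Rule N ((rel w u ∷ Γ ⇒ lab u A ∷ Δ) ∷ []) (Γ ⇒ lab w (□' A) ∷ Δ)
    L◇ : ∀ {w u A Γ Δ} → FreshLabel u (lab w (◇' A) ∷ Γ ⇒ Δ) →
      Rule N ((rel w u ∷ lab u A ∷ Γ ⇒ Δ) ∷ []) (lab w (◇' A) ∷ Γ ⇒ Δ)
    R◇ : ∀ {w v A Γ Δ} →
      Rule N ((rel w v ∷ Γ ⇒ lab w (◇' A) ∷ lab v A ∷ Δ) ∷ [])
             (rel w v ∷ Γ ⇒ lab w (◇' A) ∷ Δ)
    Ref= : ∀ {w x Γ Δ} →
      Rule N ((lab w (eq x x) ∷ Γ ⇒ Δ) ∷ []) (Γ ⇒ Δ)
    RigVar : ∀ {w v y z Γ Δ} →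
      Rule N ((lab v (eq y z) ∷ lab w (eq y z) ∷ Γ ⇒ Δ) ∷ [])
             (lab w (eq y z) ∷ Γ ⇒ Δ)
    Repl-D : ∀ {w a b x y z Γ Δ} →
      Rule N ((subE z x (den (var a) b w) ∷ subE y x (den (var a) b w) ∷ lab w (eq y z) ∷ Γ ⇒ Δ) ∷ [])
             (subE y x (den (var a) b w) ∷ lab w (eq y z) ∷ Γ ⇒ Δ)
    Repl-dom : ∀ {w a x y z Γ Δ} →
      Rule N ((subE z x (dom a w) ∷ subE y x (dom a w) ∷ lab w (eq y z) ∷ Γ ⇒ Δ) ∷ [])
             (subE y x (dom a w) ∷ lab w (eq y z) ∷ Γ ⇒ Δ)
    Repl-at : ∀ {w p x y z Γ Δ} → IsAtomic p →
      Rule N ((subE z x (lab w p) ∷ subE y x (lab w p) ∷ lab w (eq y z) ∷ Γ ⇒ Δ) ∷ [])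
             (subE y x (lab w p) ∷ lab w (eq y z) ∷ Γ ⇒ Δ)
    Lλ : ∀ {w x z B t Γ Δ} → FreshVar z (lab w (lam x B t) ∷ Γ ⇒ Δ) →
      Rule N ((den t z w ∷ lab w (subF z x B) ∷ Γ ⇒ Δ) ∷ [])
             (lab w (lam x B t) ∷ Γ ⇒ Δ)
    Rλ : ∀ {w x y B t Γ Δ} →
      Rule N ((Γ ⇒ lab w (lam x B t) ∷ den t y w ∷ Δ) ∷
              (Γ ⇒ lab w (lam x B t) ∷ lab w (subF y x B) ∷ Δ) ∷ [])
             (Γ ⇒ lab w (lam x B t) ∷ Δ)
    LD₁ : ∀ {w x₁ x₂ A Γ Δ} →
      Rule N ((lab w (subF x₂ x₁ A) ∷ den (ι x₁ A) x₂ w ∷ Γ ⇒ Δ) ∷ [])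
             (den (ι x₁ A) x₂ w ∷ Γ ⇒ Δ)
    LD₂ : ∀ {w x₁ x₂ y A Γ Δ} →
      Rule N ((den (ι x₁ A) x₂ w ∷ Γ ⇒ lab w (subF y x₁ A) ∷ Δ) ∷
              (lab w (eq x₂ y) ∷ den (ι x₁ A) x₂ w ∷ Γ ⇒ Δ) ∷ [])
             (den (ι x₁ A) x₂ w ∷ Γ ⇒ Δ)
    RD : ∀ {w x₁ x₂ z A Γ Δ} → FreshVar z (Γ ⇒ den (ι x₁ A) x₂ w ∷ Δ) →
      Rule N ((Γ ⇒ lab w (subF x₂ x₁ A) ∷ Δ) ∷
              (lab w (subF z x₁ A) ∷ Γ ⇒ lab w (eq x₂ z) ∷ Δ) ∷ [])
             (Γ ⇒ den (ι x₁ A) x₂ w ∷ Δ)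
    DenVar : ∀ {w x Γ Δ} →
      Rule N ((den (var x) x w ∷ Γ ⇒ Δ) ∷ []) (Γ ⇒ Δ)
    DenId : ∀ {w x y Γ Δ} →
      Rule N ((lab w (eq y x) ∷ den (var y) x w ∷ Γ ⇒ Δ) ∷ [])
             (den (var y) x w ∷ Γ ⇒ Δ)
    Ref-W : ∀ {w Γ Δ} → T (N ref-W) →
      Rule N ((rel w w ∷ Γ ⇒ Δ) ∷ []) (Γ ⇒ Δ)
    Ser : ∀ {w u Γ Δ} → T (N ser) → FreshLabel u (Γ ⇒ Δ) →
      Rule N ((rel w u ∷ Γ ⇒ Δ) ∷ []) (Γ ⇒ Δ)
    Trans : ∀ {w v u Γ Δ} → T (N trans) →
      Rule N ((rel w u ∷ rel w v ∷ rel v u ∷ Γ ⇒ Δ) ∷ [])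
             (rel w v ∷ rel v u ∷ Γ ⇒ Δ)
    Eucl : ∀ {w v u Γ Δ} → T (N eucl) →
      Rule N ((rel v u ∷ rel w v ∷ rel w u ∷ Γ ⇒ Δ) ∷ [])
             (rel w v ∷ rel w u ∷ Γ ⇒ Δ)
    Euclᶜ : ∀ {w v Γ Δ} → T (N eucl) →
      Rule N ((rel v v ∷ rel w v ∷ Γ ⇒ Δ) ∷ []) (rel w v ∷ Γ ⇒ Δ)
    Incr : ∀ {x w v Γ Δ} → T (N incr) →
      Rule N ((dom x v ∷ dom x w ∷ rel w v ∷ Γ ⇒ Δ) ∷ [])
             (dom x w ∷ rel w v ∷ Γ ⇒ Δ)
    Decr : ∀ {x w v Γ Δ} → T (N decr) →
      Rule N ((dom x w ∷ dom x v ∷ rel w v ∷ Γ ⇒ Δ) ∷ [])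
             (dom x v ∷ rel w v ∷ Γ ⇒ Δ)
    Cons : ∀ {x w Γ Δ} → T (N cons) →
      Rule N ((dom x w ∷ Γ ⇒ Δ) ∷ []) (Γ ⇒ Δ)

  -- Deriv N n s : s has a derivation in G3Qλ.K + N of height at most n
  -- (height = number of nodes on the longest branch); all sequents in
  -- the derivation are pure and well-formed.
  data Deriv (N : NL → Bool) : ℕ → Seq S → Set where
    node : ∀ {n ps c c'} → Rule N ps c → c ≈ₛ c' → GoodSeq c' →
           All (Deriv N n) ps → Deriv N (ℕ.suc n) c'

  DerivableH : (N : NL → Bool) → ℕ → Seq S → Set
  DerivableH N n s = Σ (Seq S) λ s' → AlphaVariant s s' × Deriv N n s'

-- Label substitution is the easy half: any map h on labels sends a
-- derivation to a derivation of the same height.  Only the freshness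
-- conditions of R□, L◇ and Ser need care; there the eigenlabel is
-- re-chosen fresh for the image sequent.
--
-- Variable substitution [y/x] acts on free occurrences only, so it does
-- not commute with the rules directly.  We instead use UNIFORM renamings
-- f : Var → Var, which rename every occurrence, free or bound.  A uniform
-- renaming that is injective at the bound variables of a sequent sends a
-- derivation of it to a derivation of its image of the same height; the
-- eigenvariables of R∀, L∃, Lλ and RD are re-chosen fresh, and the Repl
-- instances are re-expressed with a fresh replaced variable.  Given a
-- derivation of an alphabetic variant s' of Γ ⇒ Δ, we choose f sending
-- the bound variables of s' to fresh variables, x to y, and fixing every
-- other variable of s'; since y is free for x, the image of s' is an
-- alphabetic variant of (Γ ⇒ Δ)[y/x], which proves the theorem.
module Submission where

open import Defs
open import Data.Nat using (ℕ; zero; suc; _+_; _≡ᵇ_; _≟_; _<_; _<?_; s≤s)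
open import Data.Nat.Properties
  using (≡ᵇ⇒≡; ≤-trans; m≤m+n; m≤n+m; <-irrefl; <⇒≢; <-≤-trans; +-cancelˡ-≡; +-assoc)
open import Data.Nat.ListAction using (sum)
open import Data.Bool using (Bool; true; false; if_then_else_; T)
open import Data.Bool.Properties using (if-float)
open import Data.List using (List; []; _∷_; _++_; map; concatMap)
open import Data.List.Relation.Unary.All using (All; []; _∷_)
  renaming (lookup to All-lookup; head to All-head; tail to All-tail; tabulate to All-tabulate)
open import Data.List.Relation.Unary.All.Properties using (++⁻ˡ; ++⁻ʳ)
open import Data.List.Relation.Unary.Any using (here; there)
open import Data.List.Membership.Propositional using (_∈_; _∉_; find; lose)
open import Data.List.Membership.Propositional.Properties
  using (∈-++⁺ˡ; ∈-++⁺ʳ; ∈-++⁻; ∈-filter⁺; ∈-filter⁻; ∈-map⁺; ∈-map⁻; ∈-concatMap⁺; ∈-concatMap⁻)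
open import Data.List.Membership.DecPropositional _≟_ using (_∈?_)
open import Data.List.Relation.Binary.Permutation.Propositional using (↭-sym)
open import Data.List.Relation.Binary.Permutation.Propositional.Properties
  using (All-resp-↭) renaming (map⁺ to ↭-map⁺)
open import Data.List.Relation.Binary.Pointwise using (Pointwise; []; _∷_)
open import Data.List.Properties using (map-++)
open import Data.Vec using (Vec; toList) renaming ([] to v[]; _∷_ to _v∷_)
import Data.Vec as Vec
open import Data.Vec.Properties using (toList-map)
import Data.Vec.Relation.Binary.Pointwise.Inductive as VP
open import Data.Product using (_×_; _,_; proj₁; proj₂; ∃)
open import Data.Sum using (_⊎_; inj₁; inj₂)
open import Data.Unit using (tt)
open import Data.Empty using (⊥-elim)
open import Relation.Nullary using (¬?; yes; no)
open import Relation.Binary.PropositionalEquality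
  using (_≡_; _≢_; refl; sym; cong; cong₂; subst; module ≡-Reasoning)
  renaming (trans to ≡-trans)

≡ᵇ-refl : ∀ a → (a ≡ᵇ a) ≡ true
≡ᵇ-refl zero = refl
≡ᵇ-refl (suc a) = ≡ᵇ-refl a

≢⇒≡ᵇ-false : ∀ {a b} → a ≢ b → (a ≡ᵇ b) ≡ false
≢⇒≡ᵇ-false {a} {b} a≢b with a ≡ᵇ b in eq
... | true = ⊥-elim (a≢b (≡ᵇ⇒≡ a b (subst T (sym eq) tt)))
... | false = refl

≡ᵇ-cases : ∀ a b → (a ≡ b) ⊎ (a ≢ b × (a ≡ᵇ b) ≡ false)
≡ᵇ-cases a b with a ≟ b
... | yes a≡b = inj₁ a≡b
... | no a≢b = inj₂ (a≢b , ≢⇒≡ᵇ-false a≢b)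

_[_↦_] : (ℕ → ℕ) → ℕ → ℕ → ℕ → ℕ
(f [ z ↦ Z ]) v = if v ≡ᵇ z then Z else f v

update-here : ∀ f z Z → (f [ z ↦ Z ]) z ≡ Z
update-here f z Z rewrite ≡ᵇ-refl z = refl

update-there : ∀ f z Z {v} → v ≢ z → (f [ z ↦ Z ]) v ≡ f v
update-there f z Z v≢z rewrite ≢⇒≡ᵇ-false v≢z = refl

fresh : List ℕ → ℕ
fresh L = suc (sum L)

∈⇒<fresh : ∀ {v} L → v ∈ L → v < fresh L
∈⇒<fresh (a ∷ L) (here refl) = s≤s (m≤m+n a (sum L))
∈⇒<fresh (a ∷ L) (there v∈L) = ≤-trans (∈⇒<fresh L v∈L) (s≤s (m≤n+m (sum L) a))

fresh-∉ : ∀ L → fresh L ∉ L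
fresh-∉ L i = <-irrefl refl (∈⇒<fresh L i)

∉-++ˡ : ∀ {A : Set} {v : A} xs {ys} → v ∉ xs ++ ys → v ∉ xs
∉-++ˡ xs v∉ i = v∉ (∈-++⁺ˡ i)

∉-++ʳ : ∀ {A : Set} {v : A} xs {ys} → v ∉ xs ++ ys → v ∉ ys
∉-++ʳ xs v∉ i = v∉ (∈-++⁺ʳ xs i)

∈-concatMap-find : ∀ {A : Set} (F : A → List ℕ) L {v} → v ∈ concatMap F L → ∃ λ E → E ∈ L × v ∈ F E
∈-concatMap-find F L i = find (∈-concatMap⁻ F {xs = L} i)

∈-concatMap-intro : ∀ {A : Set} (F : A → List ℕ) L {v E} → E ∈ L → v ∈ F E → v ∈ concatMap F L
∈-concatMap-intro F L E∈L v∈FE = ∈-concatMap⁺ F (lose E∈L v∈FE)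

module _ {S : Signature} where

  subV : Var → Var → Var → Var
  subV = sv {S}

  subL : Label → Label → Label → Label
  subL = sl {S}

  removeV : Var → List Var → List Var
  removeV = remove {S}

  subV-here : ∀ y x → subV y x x ≡ y
  subV-here y x rewrite ≡ᵇ-refl x = refl

  subV-there : ∀ y x {v} → v ≢ x → subV y x v ≡ v
  subV-there y x v≢x rewrite ≢⇒≡ᵇ-false v≢x = refl

  ∈-remove⁺ : ∀ {v} x L → v ∈ L → v ≢ x → v ∈ removeV x L
  ∈-remove⁺ x L i v≢x = ∈-filter⁺ {P = λ z → z ≢ x} (λ z → ¬? (z ≟ x)) i v≢x

  ∈-remove⁻ : ∀ {v} x L → v ∈ removeV x L → v ∈ L × v ≢ x
  ∈-remove⁻ x L i = ∈-filter⁻ {P = λ z → z ≢ x} (λ z → ¬? (z ≟ x)) i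

  ∉-remove : ∀ {v} x L → v ∉ removeV x L → v ≢ x → v ∉ L
  ∉-remove x L v∉ v≢x i = v∉ (∈-remove⁺ x L i v≢x)

  mutual
    renT : (Var → Var) → Term S → Term S
    renT f (var a) = var (f a)
    renT f (ι z A) = ι (f z) (renF f A)

    renF : (Var → Var) → Formula S → Formula S
    renF f (pred P xs) = pred P (Vec.map f xs)
    renF f (eq a b) = eq (f a) (f b)
    renF f ⊥' = ⊥'
    renF f (A ∧' B) = renF f A ∧' renF f B
    renF f (A ∨' B) = renF f A ∨' renF f B
    renF f (A ⊃' B) = renF f A ⊃' renF f B
    renF f (∀' z A) = ∀' (f z) (renF f A)
    renF f (∃' z A) = ∃' (f z) (renF f A)
    renF f (□' A) = □' (renF f A)
    renF f (◇' A) = ◇' (renF f A)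
    renF f (lam z A t) = lam (f z) (renF f A) (renT f t)

  renE : (Var → Var) → Expr S → Expr S
  renE f (lab w A) = lab w (renF f A)
  renE f (dom z w) = dom (f z) w
  renE f (rel w v) = rel w v
  renE f (den t z w) = den (renT f t) (f z) w

  renS : (Var → Var) → Seq S → Seq S
  renS f (Γ ⇒ Δ) = map (renE f) Γ ⇒ map (renE f) Δ

  relabelE : (Label → Label) → Expr S → Expr S
  relabelE h (lab w A) = lab (h w) A
  relabelE h (dom z w) = dom z (h w)
  relabelE h (rel w v) = rel (h w) (h v)
  relabelE h (den t z w) = den t z (h w)

  relabelS : (Label → Label) → Seq S → Seq S
  relabelS h (Γ ⇒ Δ) = map (relabelE h) Γ ⇒ map (relabelE h) Δ

  InjAt : (Var → Var) → Var → Set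
  InjAt f b = ∀ v → f v ≡ f b → v ≡ b

  -- Renaming commutes with substitution when it is injective at the
  -- substituted variable (so binders of x stay binders of f x and no
  -- other binder is confused with it).
  renV-subV : ∀ f y x → InjAt f x → ∀ a → f (subV y x a) ≡ subV (f y) (f x) (f a)
  renV-subV f y x inj a with ≡ᵇ-cases a x
  ... | inj₁ refl = ≡-trans (cong f (subV-here y a)) (sym (subV-here (f y) (f a)))
  ... | inj₂ (a≢x , _) =
    ≡-trans (cong f (subV-there y x a≢x)) (sym (subV-there (f y) (f x) (λ e → a≢x (inj a e))))

  renVec-subVec : ∀ f y x → InjAt f x → ∀ {n} (xs : Vec Var n) →
    Vec.map f (Vec.map (subV y x) xs) ≡ Vec.map (subV (f y) (f x)) (Vec.map f xs)
  renVec-subVec f y x inj v[] = refl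
  renVec-subVec f y x inj (a v∷ xs) = cong₂ _v∷_ (renV-subV f y x inj a) (renVec-subVec f y x inj xs)

  mutual
    renT-subT : ∀ f y x → InjAt f x → ∀ t → renT f (subT y x t) ≡ subT (f y) (f x) (renT f t)
    renT-subT f y x inj (var a) = cong var (renV-subV f y x inj a)
    renT-subT f y x inj (ι b A) with ≡ᵇ-cases b x
    ... | inj₁ refl rewrite ≡ᵇ-refl b | ≡ᵇ-refl (f b) = refl
    ... | inj₂ (b≢x , e) rewrite e | ≢⇒≡ᵇ-false {f b} {f x} (λ p → b≢x (inj b p)) =
      cong (ι (f b)) (renF-subF f y x inj A)

    renF-subF : ∀ f y x → InjAt f x → ∀ A → renF f (subF y x A) ≡ subF (f y) (f x) (renF f A)
    renF-subF f y x inj (pred P xs) = cong (pred P) (renVec-subVec f y x inj xs)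
    renF-subF f y x inj (eq a b) = cong₂ eq (renV-subV f y x inj a) (renV-subV f y x inj b)
    renF-subF f y x inj ⊥' = refl
    renF-subF f y x inj (A ∧' B) = cong₂ _∧'_ (renF-subF f y x inj A) (renF-subF f y x inj B)
    renF-subF f y x inj (A ∨' B) = cong₂ _∨'_ (renF-subF f y x inj A) (renF-subF f y x inj B)
    renF-subF f y x inj (A ⊃' B) = cong₂ _⊃'_ (renF-subF f y x inj A) (renF-subF f y x inj B)
    renF-subF f y x inj (∀' b A) with ≡ᵇ-cases b x
    ... | inj₁ refl rewrite ≡ᵇ-refl b | ≡ᵇ-refl (f b) = refl
    ... | inj₂ (b≢x , e) rewrite e | ≢⇒≡ᵇ-false {f b} {f x} (λ p → b≢x (inj b p)) =
      cong (∀' (f b)) (renF-subF f y x inj A)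
    renF-subF f y x inj (∃' b A) with ≡ᵇ-cases b x
    ... | inj₁ refl rewrite ≡ᵇ-refl b | ≡ᵇ-refl (f b) = refl
    ... | inj₂ (b≢x , e) rewrite e | ≢⇒≡ᵇ-false {f b} {f x} (λ p → b≢x (inj b p)) =
      cong (∃' (f b)) (renF-subF f y x inj A)
    renF-subF f y x inj (□' A) = cong □' (renF-subF f y x inj A)
    renF-subF f y x inj (◇' A) = cong ◇' (renF-subF f y x inj A)
    renF-subF f y x inj (lam b A t) with ≡ᵇ-cases b x
    ... | inj₁ refl rewrite ≡ᵇ-refl b | ≡ᵇ-refl (f b) =
      cong (lam (f b) (renF f A)) (renT-subT f y b inj t)
    ... | inj₂ (b≢x , e) rewrite e | ≢⇒≡ᵇ-false {f b} {f x} (λ p → b≢x (inj b p)) =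
      cong₂ (lam (f b)) (renF-subF f y x inj A) (renT-subT f y x inj t)

  mutual
    BVT-subT : ∀ y x t → BVT (subT {S} y x t) ≡ BVT t
    BVT-subT y x (var a) = refl
    BVT-subT y x (ι b A) with ≡ᵇ-cases b x
    ... | inj₁ refl rewrite ≡ᵇ-refl b = refl
    ... | inj₂ (_ , e) rewrite e = cong (b ∷_) (BVF-subF y x A)

    BVF-subF : ∀ y x A → BVF (subF {S} y x A) ≡ BVF A
    BVF-subF y x (pred P xs) = refl
    BVF-subF y x (eq a b) = refl
    BVF-subF y x ⊥' = refl
    BVF-subF y x (A ∧' B) = cong₂ _++_ (BVF-subF y x A) (BVF-subF y x B)
    BVF-subF y x (A ∨' B) = cong₂ _++_ (BVF-subF y x A) (BVF-subF y x B)
    BVF-subF y x (A ⊃' B) = cong₂ _++_ (BVF-subF y x A) (BVF-subF y x B)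
    BVF-subF y x (∀' b A) with ≡ᵇ-cases b x
    ... | inj₁ refl rewrite ≡ᵇ-refl b = refl
    ... | inj₂ (_ , e) rewrite e = cong (b ∷_) (BVF-subF y x A)
    BVF-subF y x (∃' b A) with ≡ᵇ-cases b x
    ... | inj₁ refl rewrite ≡ᵇ-refl b = refl
    ... | inj₂ (_ , e) rewrite e = cong (b ∷_) (BVF-subF y x A)
    BVF-subF y x (□' A) = BVF-subF y x A
    BVF-subF y x (◇' A) = BVF-subF y x A
    BVF-subF y x (lam b A t) with ≡ᵇ-cases b x
    ... | inj₁ refl rewrite ≡ᵇ-refl b = cong (λ L → b ∷ BVF A ++ L) (BVT-subT y b t)
    ... | inj₂ (_ , e) rewrite e = cong (b ∷_) (cong₂ _++_ (BVF-subF y x A) (BVT-subT y x t))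

  mutual
    BVT-renT : ∀ f t → BVT (renT f t) ≡ map f (BVT t)
    BVT-renT f (var a) = refl
    BVT-renT f (ι b A) = cong (f b ∷_) (BVF-renF f A)

    BVF-renF : ∀ f A → BVF (renF f A) ≡ map f (BVF A)
    BVF-renF f (pred P xs) = refl
    BVF-renF f (eq a b) = refl
    BVF-renF f ⊥' = refl
    BVF-renF f (A ∧' B) = BVF-renF-++ f A B
    BVF-renF f (A ∨' B) = BVF-renF-++ f A B
    BVF-renF f (A ⊃' B) = BVF-renF-++ f A B
    BVF-renF f (∀' b A) = cong (f b ∷_) (BVF-renF f A)
    BVF-renF f (∃' b A) = cong (f b ∷_) (BVF-renF f A)
    BVF-renF f (□' A) = BVF-renF f A
    BVF-renF f (◇' A) = BVF-renF f A
    BVF-renF f (lam b A t) =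
      cong (f b ∷_) (≡-trans (cong₂ _++_ (BVF-renF f A) (BVT-renT f t)) (sym (map-++ f (BVF A) (BVT t))))

    BVF-renF-++ : ∀ f A B → BVF (renF f A) ++ BVF (renF f B) ≡ map f (BVF A ++ BVF B)
    BVF-renF-++ f A B = ≡-trans (cong₂ _++_ (BVF-renF f A) (BVF-renF f B)) (sym (map-++ f (BVF A) (BVF B)))

  BVE-renE : ∀ f E → BVE (renE f E) ≡ map f (BVE E)
  BVE-renE f (lab w A) = BVF-renF f A
  BVE-renE f (dom z w) = refl
  BVE-renE f (rel w v) = refl
  BVE-renE f (den t z w) = BVT-renT f t

  ImageOf : (Var → Var) → Var → List Var → Set
  ImageOf f v L = ∃ λ u → u ∈ L × v ≡ f u

  image-++ : ∀ {f v} L M {L' M'} → (v ∈ L' → ImageOf f v L) → (v ∈ M' → ImageOf f v M) →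
             v ∈ L' ++ M' → ImageOf f v (L ++ M)
  image-++ L M {L'} imL imM i with ∈-++⁻ L' i
  ... | inj₁ j = let (u , k , e) = imL j in u , ∈-++⁺ˡ k , e
  ... | inj₂ j = let (u , k , e) = imM j in u , ∈-++⁺ʳ L k , e

  image-remove : ∀ {f v} b L L' → (v ∈ L' → ImageOf f v L) → v ∈ removeV (f b) L' → ImageOf f v (removeV b L)
  image-remove {f} b L L' im i with ∈-remove⁻ (f b) L' i
  ... | (j , v≢fb) with im j
  ... | (u , k , refl) = u , ∈-remove⁺ b L k (λ e → v≢fb (cong f e)) , refl

  mutual
    FVT-renT : ∀ f t {v} → v ∈ FVT (renT f t) → ImageOf f v (FVT t)
    FVT-renT f (var a) (here refl) = a , here refl , refl
    FVT-renT f (ι b A) i = image-remove b (FVF A) (FVF (renF f A)) (FVF-renF f A) i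

    FVF-renF : ∀ f A {v} → v ∈ FVF (renF f A) → ImageOf f v (FVF A)
    FVF-renF f (pred P xs) i rewrite toList-map f xs = ∈-map⁻ f i
    FVF-renF f (eq a b) (here refl) = a , here refl , refl
    FVF-renF f (eq a b) (there (here refl)) = b , there (here refl) , refl
    FVF-renF f (A ∧' B) i = image-++ (FVF A) (FVF B) (FVF-renF f A) (FVF-renF f B) i
    FVF-renF f (A ∨' B) i = image-++ (FVF A) (FVF B) (FVF-renF f A) (FVF-renF f B) i
    FVF-renF f (A ⊃' B) i = image-++ (FVF A) (FVF B) (FVF-renF f A) (FVF-renF f B) i
    FVF-renF f (∀' b A) i = image-remove b (FVF A) (FVF (renF f A)) (FVF-renF f A) i
    FVF-renF f (∃' b A) i = image-remove b (FVF A) (FVF (renF f A)) (FVF-renF f A) i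
    FVF-renF f (□' A) i = FVF-renF f A i
    FVF-renF f (◇' A) i = FVF-renF f A i
    FVF-renF f (lam b A t) i =
      image-++ (removeV b (FVF A)) (FVT t)
        (image-remove b (FVF A) (FVF (renF f A)) (FVF-renF f A)) (FVT-renT f t) i

  FVE-renE : ∀ f E {v} → v ∈ FVE (renE f E) → ImageOf f v (FVE E)
  FVE-renE f (lab w A) i = FVF-renF f A i
  FVE-renE f (dom z w) (here refl) = z , here refl , refl
  FVE-renE f (den t z w) i =
    image-++ (FVT t) (z ∷ []) (FVT-renT f t) (λ { (here refl) → z , here refl , refl }) i

  renVec-update : ∀ f z Z {n} (xs : Vec Var n) → z ∉ toList xs → Vec.map (f [ z ↦ Z ]) xs ≡ Vec.map f xs
  renVec-update f z Z v[] _ = refl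
  renVec-update f z Z (a v∷ xs) z∉ =
    cong₂ _v∷_ (update-there f z Z (λ e → z∉ (here (sym e)))) (renVec-update f z Z xs (λ i → z∉ (there i)))

  mutual
    renT-update : ∀ f z Z t → z ∉ FVT t → z ∉ BVT t → renT (f [ z ↦ Z ]) t ≡ renT f t
    renT-update f z Z (var a) z∉F _ = cong var (update-there f z Z (λ e → z∉F (here (sym e))))
    renT-update f z Z (ι b A) z∉F z∉B
      rewrite update-there f z Z {b} (λ e → z∉B (here (sym e)))
            | renF-update f z Z A (∉-remove b (FVF A) z∉F (λ e → z∉B (here e))) (λ i → z∉B (there i)) = refl

    renF-update : ∀ f z Z A → z ∉ FVF A → z ∉ BVF A → renF (f [ z ↦ Z ]) A ≡ renF f A
    renF-update f z Z (pred P xs) z∉F _ = cong (pred P) (renVec-update f z Z xs z∉F)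
    renF-update f z Z (eq a b) z∉F _ =
      cong₂ eq (update-there f z Z (λ e → z∉F (here (sym e))))
               (update-there f z Z (λ e → z∉F (there (here (sym e)))))
    renF-update f z Z ⊥' _ _ = refl
    renF-update f z Z (A ∧' B) z∉F z∉B =
      cong₂ _∧'_ (renF-update f z Z A (∉-++ˡ (FVF A) z∉F) (∉-++ˡ (BVF A) z∉B))
                 (renF-update f z Z B (∉-++ʳ (FVF A) z∉F) (∉-++ʳ (BVF A) z∉B))
    renF-update f z Z (A ∨' B) z∉F z∉B =
      cong₂ _∨'_ (renF-update f z Z A (∉-++ˡ (FVF A) z∉F) (∉-++ˡ (BVF A) z∉B))
                 (renF-update f z Z B (∉-++ʳ (FVF A) z∉F) (∉-++ʳ (BVF A) z∉B))
    renF-update f z Z (A ⊃' B) z∉F z∉B =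
      cong₂ _⊃'_ (renF-update f z Z A (∉-++ˡ (FVF A) z∉F) (∉-++ˡ (BVF A) z∉B))
                 (renF-update f z Z B (∉-++ʳ (FVF A) z∉F) (∉-++ʳ (BVF A) z∉B))
    renF-update f z Z (∀' b A) z∉F z∉B
      rewrite update-there f z Z {b} (λ e → z∉B (here (sym e)))
            | renF-update f z Z A (∉-remove b (FVF A) z∉F (λ e → z∉B (here e))) (λ i → z∉B (there i)) = refl
    renF-update f z Z (∃' b A) z∉F z∉B
      rewrite update-there f z Z {b} (λ e → z∉B (here (sym e)))
            | renF-update f z Z A (∉-remove b (FVF A) z∉F (λ e → z∉B (here e))) (λ i → z∉B (there i)) = refl
    renF-update f z Z (□' A) z∉F z∉B = cong □' (renF-update f z Z A z∉F z∉B)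
    renF-update f z Z (◇' A) z∉F z∉B = cong ◇' (renF-update f z Z A z∉F z∉B)
    renF-update f z Z (lam b A t) z∉F z∉B
      rewrite update-there f z Z {b} (λ e → z∉B (here (sym e)))
            | renF-update f z Z A
                (∉-remove b (FVF A) (∉-++ˡ (removeV b (FVF A)) z∉F) (λ e → z∉B (here e)))
                (∉-++ˡ (BVF A) (λ i → z∉B (there i)))
            | renT-update f z Z t (∉-++ʳ (removeV b (FVF A)) z∉F) (∉-++ʳ (BVF A) (λ i → z∉B (there i))) = refl

  renE-update : ∀ f z Z E → z ∉ FVE E → z ∉ BVE E → renE (f [ z ↦ Z ]) E ≡ renE f E
  renE-update f z Z (lab w A) z∉F z∉B = cong (lab w) (renF-update f z Z A z∉F z∉B)
  renE-update f z Z (dom a w) z∉F _ = cong (λ u → dom u w) (update-there f z Z (λ e → z∉F (here (sym e))))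
  renE-update f z Z (rel w v) _ _ = refl
  renE-update f z Z (den t a w) z∉F z∉B =
    cong₂ (λ u b → den u b w) (renT-update f z Z t (∉-++ˡ (FVT t) z∉F) z∉B)
      (update-there f z Z (λ e → z∉F (∈-++⁺ʳ (FVT t) (here (sym e)))))

  renList-update : ∀ f z Z Γ → z ∉ concatMap FVE Γ → z ∉ concatMap BVE Γ →
                   map (renE (f [ z ↦ Z ])) Γ ≡ map (renE f) Γ
  renList-update f z Z [] _ _ = refl
  renList-update f z Z (E ∷ Γ) z∉F z∉B =
    cong₂ _∷_ (renE-update f z Z E (∉-++ˡ (FVE E) z∉F) (∉-++ˡ (BVE E) z∉B))
              (renList-update f z Z Γ (∉-++ʳ (FVE E) z∉F) (∉-++ʳ (BVE E) z∉B))

  module _ (Γ Δ : List (Expr S)) {z : Var} (z∉ : z ∉ Vars (Γ ⇒ Δ)) where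
    ∉Vars-FVΓ : z ∉ concatMap FVE Γ
    ∉Vars-FVΓ i = z∉ (∈-++⁺ˡ (∈-++⁺ˡ i))

    ∉Vars-FVΔ : z ∉ concatMap FVE Δ
    ∉Vars-FVΔ i = z∉ (∈-++⁺ˡ (∈-++⁺ʳ (concatMap FVE Γ) i))

    ∉Vars-BVΓ : z ∉ concatMap BVE Γ
    ∉Vars-BVΓ i = z∉ (∈-++⁺ʳ (concatMap FVE Γ ++ concatMap FVE Δ) (∈-++⁺ˡ i))

    ∉Vars-BVΔ : z ∉ concatMap BVE Δ
    ∉Vars-BVΔ i = z∉ (∈-++⁺ʳ (concatMap FVE Γ ++ concatMap FVE Δ) (∈-++⁺ʳ (concatMap BVE Γ) i))

  SafeE : (Var → Var) → Expr S → Set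
  SafeE f E = All (InjAt f) (BVE E)

  Safe : (Var → Var) → Seq S → Set
  Safe f (Γ ⇒ Δ) = All (SafeE f) Γ × All (SafeE f) Δ

  InjAt-update : ∀ f z Z b → InjAt f b → b ≢ z → f b ≢ Z → InjAt (f [ z ↦ Z ]) b
  InjAt-update f z Z b inj b≢z fb≢Z v e with ≡ᵇ-cases v z
  ... | inj₁ refl = ⊥-elim (fb≢Z (sym (≡-trans (sym (update-here f v Z)) (≡-trans e (update-there f v Z b≢z)))))
  ... | inj₂ (v≢z , _) = inj v (≡-trans (sym (update-there f z Z v≢z)) (≡-trans e (update-there f z Z b≢z)))

  SafeList-update : ∀ f z Z L → All (SafeE f) L → z ∉ concatMap BVE L →
                    Z ∉ concatMap BVE (map (renE f) L) → All (SafeE (f [ z ↦ Z ])) L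
  SafeList-update f z Z [] [] _ _ = []
  SafeList-update f z Z (E ∷ L) (safe ∷ safes) z∉ Z∉ =
    update-bound (BVE E) safe (∉-++ˡ (BVE E) z∉) (subst (Z ∉_) (BVE-renE f E) (∉-++ˡ (BVE (renE f E)) Z∉))
    ∷ SafeList-update f z Z L safes (∉-++ʳ (BVE E) z∉) (∉-++ʳ (BVE (renE f E)) Z∉)
    where
    update-bound : ∀ bs → All (InjAt f) bs → z ∉ bs → Z ∉ map f bs → All (InjAt (f [ z ↦ Z ])) bs
    update-bound [] [] _ _ = []
    update-bound (b ∷ bs) (inj ∷ injs) z∉bs Z∉bs =
      InjAt-update f z Z b inj (λ e → z∉bs (here (sym e))) (λ e → Z∉bs (here (sym e)))
      ∷ update-bound bs injs (λ i → z∉bs (there i)) (λ i → Z∉bs (there i))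

  Safe-update : ∀ f z Z Γ Δ → Safe f (Γ ⇒ Δ) → z ∉ Vars (Γ ⇒ Δ) → Z ∉ Vars (renS f (Γ ⇒ Δ)) →
                Safe (f [ z ↦ Z ]) (Γ ⇒ Δ)
  Safe-update f z Z Γ Δ (safeΓ , safeΔ) z∉ Z∉ =
    SafeList-update f z Z Γ safeΓ (∉Vars-BVΓ Γ Δ z∉) (∉Vars-BVΓ (map (renE f) Γ) (map (renE f) Δ) Z∉) ,
    SafeList-update f z Z Δ safeΔ (∉Vars-BVΔ Γ Δ z∉) (∉Vars-BVΔ (map (renE f) Γ) (map (renE f) Δ) Z∉)

  Safe-↭ : ∀ f {s s'} → s ≈ₛ s' → Safe f s' → Safe f s
  Safe-↭ f {_ ⇒ _} {_ ⇒ _} (Γ↭ , Δ↭) (safeΓ , safeΔ) =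
    All-resp-↭ (↭-sym Γ↭) safeΓ , All-resp-↭ (↭-sym Δ↭) safeΔ

  SafeE-subF : ∀ f y x w A → SafeE f (lab w A) → SafeE f (lab w (subF y x A))
  SafeE-subF f y x w A = subst (All (InjAt f)) (sym (BVF-subF y x A))

  FVs-renS : ∀ f s {v} → v ∈ FVs (renS f s) → ImageOf f v (FVs s)
  FVs-renS f (Γ ⇒ Δ) = image-++ (concatMap FVE Γ) (concatMap FVE Δ) (FVList Γ) (FVList Δ)
    where
    FVList : ∀ L {v} → v ∈ concatMap FVE (map (renE f) L) → ImageOf f v (concatMap FVE L)
    FVList L i with ∈-concatMap-find FVE (map (renE f) L) i
    ... | _ , E'∈ , j with ∈-map⁻ (renE f) E'∈
    ... | E , E∈L , refl = let (u , k , e) = FVE-renE f E j in u , ∈-concatMap-intro FVE L E∈L k , e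

  BoundImage : (Var → Var) → Var → List Var → Set
  BoundImage f v L = ∃ λ b → b ∈ L × InjAt f b × v ≡ f b

  BVList-renE : ∀ f L {v} → All (SafeE f) L → v ∈ concatMap BVE (map (renE f) L) →
                BoundImage f v (concatMap BVE L)
  BVList-renE f (E ∷ L) (safe ∷ safes) i with ∈-++⁻ (BVE (renE f E)) i
  ... | inj₁ j = let (b , k , e) = ∈-map⁻ f (subst (_ ∈_) (BVE-renE f E) j)
                 in b , ∈-++⁺ˡ k , All-lookup safe k , e
  ... | inj₂ j = let (b , k , inj , e) = BVList-renE f L safes j in b , ∈-++⁺ʳ (BVE E) k , inj , e

  BVs-renS : ∀ f s {v} → Safe f s → v ∈ BVs (renS f s) → BoundImage f v (BVs s)
  BVs-renS f (Γ ⇒ Δ) (safeΓ , safeΔ) i with ∈-++⁻ (concatMap BVE (map (renE f) Γ)) i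
  ... | inj₁ j = let (b , k , inj , e) = BVList-renE f Γ safeΓ j in b , ∈-++⁺ˡ k , inj , e
  ... | inj₂ j = let (b , k , inj , e) = BVList-renE f Δ safeΔ j in b , ∈-++⁺ʳ (concatMap BVE Γ) k , inj , e

  Pure-renS : ∀ f s → Safe f s → Pure s → Pure (renS f s)
  Pure-renS f s safe pure v v∈FV v∈BV with FVs-renS f s v∈FV | BVs-renS f s safe v∈BV
  ... | a , a∈FV , refl | b , b∈BV , inj , fa≡fb =
    pure a a∈FV (subst (_∈ BVs s) (sym (inj a fa≡fb)) b∈BV)

  SuccOK-renE : ∀ f Δ → All SuccOK Δ → All (SuccOK {S}) (map (renE f) Δ)
  SuccOK-renE f [] [] = []
  SuccOK-renE f (lab w A ∷ Δ) (_ ∷ oks) = tt ∷ SuccOK-renE f Δ oks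
  SuccOK-renE f (den t z w ∷ Δ) (_ ∷ oks) = tt ∷ SuccOK-renE f Δ oks

  GoodSeq-renS : ∀ f s → Safe f s → GoodSeq s → GoodSeq (renS f s)
  GoodSeq-renS f s@(Γ ⇒ Δ) safe (pure , oks) = Pure-renS f s safe pure , SuccOK-renE f Δ oks

  ≈ₛ-renS : ∀ f {s s'} → s ≈ₛ s' → renS f s ≈ₛ renS f s'
  ≈ₛ-renS f {_ ⇒ _} {_ ⇒ _} (Γ↭ , Δ↭) = ↭-map⁺ (renE f) Γ↭ , ↭-map⁺ (renE f) Δ↭

  LabList-renE : ∀ f L → concatMap LabE (map (renE f) L) ≡ concatMap (LabE {S}) L
  LabList-renE f [] = refl
  LabList-renE f (lab w A ∷ L) = cong (w ∷_) (LabList-renE f L)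
  LabList-renE f (dom z w ∷ L) = cong (w ∷_) (LabList-renE f L)
  LabList-renE f (rel w v ∷ L) = cong (λ M → w ∷ v ∷ M) (LabList-renE f L)
  LabList-renE f (den t z w ∷ L) = cong (w ∷_) (LabList-renE f L)

  FreshLabel-renS : ∀ f u s → FreshLabel u s → FreshLabel u (renS f s)
  FreshLabel-renS f u (Γ ⇒ Δ) = subst (u ∉_) (sym (cong₂ _++_ (LabList-renE f Γ) (LabList-renE f Δ)))

  IsAtomic-renF : ∀ f {p} → IsAtomic {S} p → IsAtomic (renF f p)
  IsAtomic-renF f at-pred = at-pred
  IsAtomic-renF f at-eq = at-eq

  record Inference (N : NL → Bool) (m : ℕ) (c : Seq S) : Set where
    constructor infer
    field
      {premisses} : List (Seq S)
      rule : Rule N premisses c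
      derivs : All (Deriv N m) premisses

  RenamingIH : (NL → Bool) → ℕ → Set
  RenamingIH N m = ∀ g s → Safe g s → Deriv N m s → Deriv N m (renS g s)

  castˡ : ∀ {N m w B B' Γ Δ} → B ≡ B' → Deriv N m (lab w B ∷ Γ ⇒ Δ) → Deriv N m (lab {S} w B' ∷ Γ ⇒ Δ)
  castˡ refl d = d

  castʳ : ∀ {N m w B B' Γ Δ} → B ≡ B' → Deriv N m (Γ ⇒ lab w B ∷ Δ) → Deriv N m (Γ ⇒ lab {S} w B' ∷ Δ)
  castʳ refl d = d

  castʳ₂ : ∀ {N m w B B' E Γ Δ} → B ≡ B' →
           Deriv N m (Γ ⇒ E ∷ lab w B ∷ Δ) → Deriv N m (Γ ⇒ E ∷ lab {S} w B' ∷ Δ)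
  castʳ₂ refl d = d

  -- The eigenvariable z of a rule instance is redirected to Z, fresh for
  -- the renamed conclusion.  Then the renamed instance A[z/x] is the
  -- instance (fA)[Z/fx] of the renamed formula.
  renF-eigen : ∀ f z Z x A → z ∉ removeV x (FVF A) → z ∉ x ∷ BVF A → InjAt (f [ z ↦ Z ]) x →
               renF (f [ z ↦ Z ]) (subF z x A) ≡ subF Z (f x) (renF f A)
  renF-eigen f z Z x A z∉F z∉B inj = begin
    renF g (subF z x A)          ≡⟨ renF-subF g z x inj A ⟩
    subF (g z) (g x) (renF g A)  ≡⟨ cong₂ (λ u v → subF u v (renF g A)) (update-here f z Z) (update-there f z Z x≢z) ⟩
    subF Z (f x) (renF g A)      ≡⟨ cong (subF Z (f x)) (renF-update f z Z A z∉FA (λ i → z∉B (there i))) ⟩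
    subF Z (f x) (renF f A)      ∎
    where
    open ≡-Reasoning
    g = f [ z ↦ Z ]
    z≢x : z ≢ x
    z≢x e = z∉B (here e)
    x≢z : x ≢ z
    x≢z e = z≢x (sym e)
    z∉FA : z ∉ FVF A
    z∉FA = ∉-remove x (FVF A) z∉F z≢x

  eigenTarget : (Var → Var) → Seq S → Var
  eigenTarget f c = fresh (Vars (renS f c))

  rename-R∀ : ∀ {N m} f w x z A Γ Δ → FreshVar z (Γ ⇒ lab w (∀' x A) ∷ Δ) →
    Safe f (Γ ⇒ lab w (∀' x A) ∷ Δ) → RenamingIH N m →
    Deriv N m (dom z w ∷ Γ ⇒ lab w (subF z x A) ∷ Δ) → Inference N m (renS f (Γ ⇒ lab w (∀' x A) ∷ Δ))
  rename-R∀ f w x z A Γ Δ z∉ safe ih d = infer (R∀ (fresh-∉ _)) (subst (Deriv _ _) premiss d' ∷ [])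
    where
    Δ' = lab w (∀' x A) ∷ Δ
    Z = eigenTarget f (Γ ⇒ Δ')
    safe' = Safe-update f z Z Γ Δ' safe z∉ (fresh-∉ _)
    d' = ih (f [ z ↦ Z ]) _
      ([] ∷ proj₁ safe' , SafeE-subF _ z x w A (All-tail (All-head (proj₂ safe'))) ∷ All-tail (proj₂ safe')) d
    z∉FΔ' = ∉Vars-FVΔ Γ Δ' z∉
    z∉BΔ' = ∉Vars-BVΔ Γ Δ' z∉
    premiss = cong₂ _⇒_
      (cong₂ _∷_ (cong (λ u → dom u w) (update-here f z Z))
                 (renList-update f z Z Γ (∉Vars-FVΓ Γ Δ' z∉) (∉Vars-BVΓ Γ Δ' z∉)))
      (cong₂ _∷_ (cong (lab w) (renF-eigen f z Z x A (∉-++ˡ (FVF (∀' x A)) z∉FΔ') (∉-++ˡ (BVF (∀' x A)) z∉BΔ')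
                                  (All-head (All-head (proj₂ safe')))))
                 (renList-update f z Z Δ (∉-++ʳ (FVF (∀' x A)) z∉FΔ') (∉-++ʳ (BVF (∀' x A)) z∉BΔ')))

  rename-L∃ : ∀ {N m} f w x z A Γ Δ → FreshVar z (lab w (∃' x A) ∷ Γ ⇒ Δ) →
    Safe f (lab w (∃' x A) ∷ Γ ⇒ Δ) → RenamingIH N m →
    Deriv N m (dom z w ∷ lab w (subF z x A) ∷ Γ ⇒ Δ) → Inference N m (renS f (lab w (∃' x A) ∷ Γ ⇒ Δ))
  rename-L∃ f w x z A Γ Δ z∉ safe ih d = infer (L∃ (fresh-∉ _)) (subst (Deriv _ _) premiss d' ∷ [])
    where
    Γ' = lab w (∃' x A) ∷ Γ
    Z = eigenTarget f (Γ' ⇒ Δ)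
    safe' = Safe-update f z Z Γ' Δ safe z∉ (fresh-∉ _)
    d' = ih (f [ z ↦ Z ]) _
      ([] ∷ SafeE-subF _ z x w A (All-tail (All-head (proj₁ safe'))) ∷ All-tail (proj₁ safe') , proj₂ safe') d
    z∉FΓ' = ∉Vars-FVΓ Γ' Δ z∉
    z∉BΓ' = ∉Vars-BVΓ Γ' Δ z∉
    premiss = cong₂ _⇒_
      (cong₂ _∷_ (cong (λ u → dom u w) (update-here f z Z))
        (cong₂ _∷_ (cong (lab w) (renF-eigen f z Z x A (∉-++ˡ (FVF (∃' x A)) z∉FΓ') (∉-++ˡ (BVF (∃' x A)) z∉BΓ')
                                    (All-head (All-head (proj₁ safe')))))
                   (renList-update f z Z Γ (∉-++ʳ (FVF (∃' x A)) z∉FΓ') (∉-++ʳ (BVF (∃' x A)) z∉BΓ'))))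
      (renList-update f z Z Δ (∉Vars-FVΔ Γ' Δ z∉) (∉Vars-BVΔ Γ' Δ z∉))

  rename-Lλ : ∀ {N m} f w x z B t Γ Δ → FreshVar z (lab w (lam x B t) ∷ Γ ⇒ Δ) →
    Safe f (lab w (lam x B t) ∷ Γ ⇒ Δ) → RenamingIH N m →
    Deriv N m (den t z w ∷ lab w (subF z x B) ∷ Γ ⇒ Δ) → Inference N m (renS f (lab w (lam x B t) ∷ Γ ⇒ Δ))
  rename-Lλ f w x z B t Γ Δ z∉ safe ih d = infer (Lλ (fresh-∉ _)) (subst (Deriv _ _) premiss d' ∷ [])
    where
    Γ' = lab w (lam x B t) ∷ Γ
    Z = eigenTarget f (Γ' ⇒ Δ)
    safe' = Safe-update f z Z Γ' Δ safe z∉ (fresh-∉ _)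
    safeBt = All-tail (All-head (proj₁ safe'))
    d' = ih (f [ z ↦ Z ]) _
      (++⁻ʳ (BVF B) safeBt ∷ SafeE-subF _ z x w B (++⁻ˡ (BVF B) safeBt) ∷ All-tail (proj₁ safe') , proj₂ safe') d
    z∉FΓ' = ∉Vars-FVΓ Γ' Δ z∉
    z∉BΓ' = ∉Vars-BVΓ Γ' Δ z∉
    z∉FB : z ∉ removeV x (FVF B)
    z∉FB i = z∉FΓ' (∈-++⁺ˡ (∈-++⁺ˡ i))
    z∉Ft : z ∉ FVT t
    z∉Ft i = z∉FΓ' (∈-++⁺ˡ (∈-++⁺ʳ (removeV x (FVF B)) i))
    z∉xB : z ∉ x ∷ BVF B
    z∉xB (here e) = z∉BΓ' (here e)
    z∉xB (there i) = z∉BΓ' (there (∈-++⁺ˡ (∈-++⁺ˡ i)))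
    z∉Bt : z ∉ BVT t
    z∉Bt i = z∉BΓ' (there (∈-++⁺ˡ (∈-++⁺ʳ (BVF B) i)))
    premiss = cong₂ _⇒_
      (cong₂ _∷_ (cong₂ (λ u v → den u v w) (renT-update f z Z t z∉Ft z∉Bt) (update-here f z Z))
        (cong₂ _∷_ (cong (lab w) (renF-eigen f z Z x B z∉FB z∉xB (All-head (All-head (proj₁ safe')))))
                   (renList-update f z Z Γ (∉-++ʳ (FVF (lam x B t)) z∉FΓ') (∉-++ʳ (BVF (lam x B t)) z∉BΓ'))))
      (renList-update f z Z Δ (∉Vars-FVΔ Γ' Δ z∉) (∉Vars-BVΔ Γ' Δ z∉))

  rename-RD : ∀ {N m} f w x₁ x₂ z A Γ Δ → FreshVar z (Γ ⇒ den (ι x₁ A) x₂ w ∷ Δ) →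
    Safe f (Γ ⇒ den (ι x₁ A) x₂ w ∷ Δ) → RenamingIH N m →
    Deriv N m (Γ ⇒ lab w (subF x₂ x₁ A) ∷ Δ) →
    Deriv N m (lab w (subF z x₁ A) ∷ Γ ⇒ lab w (eq x₂ z) ∷ Δ) →
    Inference N m (renS f (Γ ⇒ den (ι x₁ A) x₂ w ∷ Δ))
  rename-RD f w x₁ x₂ z A Γ Δ z∉ safe@(safeΓ , (inj ∷ safeA) ∷ safeΔ) ih d₁ d₂ =
    infer (RD (fresh-∉ _)) (d₁' ∷ subst (Deriv _ _) premiss d₂' ∷ [])
    where
    Δ' = den (ι x₁ A) x₂ w ∷ Δ
    Z = eigenTarget f (Γ ⇒ Δ')
    d₁' = castʳ (renF-subF f x₂ x₁ inj A) (ih f _ (safeΓ , SafeE-subF f x₂ x₁ w A safeA ∷ safeΔ) d₁)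
    safe' = Safe-update f z Z Γ Δ' safe z∉ (fresh-∉ _)
    d₂' = ih (f [ z ↦ Z ]) _
      (SafeE-subF _ z x₁ w A (All-tail (All-head (proj₂ safe'))) ∷ proj₁ safe' , [] ∷ All-tail (proj₂ safe')) d₂
    z∉FΔ' = ∉Vars-FVΔ Γ Δ' z∉
    z∉BΔ' = ∉Vars-BVΔ Γ Δ' z∉
    z∉FA : z ∉ removeV x₁ (FVF A)
    z∉FA i = z∉FΔ' (∈-++⁺ˡ (∈-++⁺ˡ i))
    x₂≢z : x₂ ≢ z
    x₂≢z e = z∉FΔ' (∈-++⁺ˡ (∈-++⁺ʳ (removeV x₁ (FVF A)) (here (sym e))))
    premiss = cong₂ _⇒_
      (cong₂ _∷_ (cong (lab w) (renF-eigen f z Z x₁ A z∉FA (∉-++ˡ (BVE (den (ι x₁ A) x₂ w)) z∉BΔ')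
                                  (All-head (All-head (proj₂ safe')))))
                 (renList-update f z Z Γ (∉Vars-FVΓ Γ Δ' z∉) (∉Vars-BVΓ Γ Δ' z∉)))
      (cong₂ _∷_ (cong (lab w) (cong₂ eq (update-there f z Z x₂≢z) (update-here f z Z)))
                 (renList-update f z Z Δ (∉-++ʳ (FVE (den (ι x₁ A) x₂ w)) z∉FΔ')
                                         (∉-++ʳ (BVE (den (ι x₁ A) x₂ w)) z∉BΔ')))

  -- A renamed Repl instance is again a Repl instance once the replaced
  -- variable x is renamed to a fresh X: f(E[v/x]) = (gE)[fv/X] for
  -- g = f [ x ↦ X ].
  data ReplTarget : Label → Expr S → Set where
    dom-target  : ∀ {a w} → ReplTarget w (dom a w)
    den-target  : ∀ {a b w} → ReplTarget w (den (var a) b w)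
    atom-target : ∀ {w p} → IsAtomic p → ReplTarget w (lab w p)

  replRule : ∀ {N w E} → ReplTarget w E → ∀ {x y z Γ Δ} →
    Rule N ((subE z x E ∷ subE y x E ∷ lab w (eq y z) ∷ Γ ⇒ Δ) ∷ []) (subE y x E ∷ lab w (eq y z) ∷ Γ ⇒ Δ)
  replRule (dom-target {a} {w}) {x} = Repl-dom {w = w} {a = a} {x = x}
  replRule (den-target {a} {b} {w}) {x} = Repl-D {w = w} {a = a} {b = b} {x = x}
  replRule (atom-target {w} {p} at) {x} = Repl-at {w = w} {p = p} {x = x} at

  ReplTarget-renE : ∀ {w E} f → ReplTarget w E → ReplTarget w (renE f E)
  ReplTarget-renE f dom-target = dom-target
  ReplTarget-renE f den-target = den-target
  ReplTarget-renE f (atom-target at) = atom-target (IsAtomic-renF f at)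

  SafeE-target : ∀ {w E} f y x → ReplTarget w E → SafeE f (subE y x E)
  SafeE-target f y x dom-target = []
  SafeE-target f y x den-target = []
  SafeE-target f y x (atom-target at-pred) = []
  SafeE-target f y x (atom-target at-eq) = []

  subV-update : ∀ f x X y a → X ≢ f a → subV (f y) X ((f [ x ↦ X ]) a) ≡ f (subV y x a)
  subV-update f x X y a X≢fa with ≡ᵇ-cases a x
  ... | inj₁ refl rewrite update-here f a X | subV-here (f y) X | subV-here y a = refl
  ... | inj₂ (a≢x , _) rewrite update-there f x X a≢x | subV-there y x a≢x =
    subV-there (f y) X (λ e → X≢fa (sym e))

  subVec-update : ∀ f x X y {n} (xs : Vec Var n) → (∀ {a} → a ∈ toList xs → X ≢ f a) →
    Vec.map (subV (f y) X) (Vec.map (f [ x ↦ X ]) xs) ≡ Vec.map f (Vec.map (subV y x) xs)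
  subVec-update f x X y v[] _ = refl
  subVec-update f x X y (a v∷ xs) X-fresh =
    cong₂ _v∷_ (subV-update f x X y a (X-fresh (here refl))) (subVec-update f x X y xs (λ i → X-fresh (there i)))

  renE-subE-target : ∀ {w E} f x X y → ReplTarget w E → (∀ {a} → a ∈ FVE E → X ≢ f a) →
    subE (f y) X (renE (f [ x ↦ X ]) E) ≡ renE f (subE y x E)
  renE-subE-target f x X y (dom-target {a} {w}) X-fresh =
    cong (λ u → dom u w) (subV-update f x X y a (X-fresh (here refl)))
  renE-subE-target f x X y (den-target {a} {b} {w}) X-fresh =
    cong₂ (λ u v → den (var u) v w) (subV-update f x X y a (X-fresh (here refl)))
      (subV-update f x X y b (X-fresh (there (here refl))))
  renE-subE-target f x X y (atom-target {w} {pred P xs} at-pred) X-fresh =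
    cong (λ us → lab w (pred P us)) (subVec-update f x X y xs X-fresh)
  renE-subE-target f x X y (atom-target {w} {eq a b} at-eq) X-fresh =
    cong₂ (λ u v → lab w (eq u v)) (subV-update f x X y a (X-fresh (here refl)))
      (subV-update f x X y b (X-fresh (there (here refl))))

  fresh-image : ∀ (f : Var → Var) L {a} → a ∈ L → fresh (map f L) ≢ f a
  fresh-image f L a∈L e = fresh-∉ (map f L) (subst (_∈ map f L) (sym e) (∈-map⁺ f a∈L))

  rename-Repl : ∀ {N m w E} f → ReplTarget w E → ∀ x y z Γ Δ →
    All (SafeE f) Γ → All (SafeE f) Δ → RenamingIH N m →
    Deriv N m (subE z x E ∷ subE y x E ∷ lab w (eq y z) ∷ Γ ⇒ Δ) →
    Inference N m (renS f (subE y x E ∷ lab w (eq y z) ∷ Γ ⇒ Δ))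
  rename-Repl {w = w} {E} f target x y z Γ Δ safeΓ safeΔ ih d =
    infer (subst (Rule _ _) (conclusion-eq (replace y)) (replRule (ReplTarget-renE (f [ x ↦ X ]) target)))
          (subst (Deriv _ _) (premiss-eq (replace z) (replace y)) d' ∷ [])
    where
    X = fresh (map f (FVE E))
    replace : ∀ v → subE (f v) X (renE (f [ x ↦ X ]) E) ≡ renE f (subE v x E)
    replace v = renE-subE-target f x X v target (fresh-image f (FVE E))
    d' = ih f _ (SafeE-target f z x target ∷ SafeE-target f y x target ∷ [] ∷ safeΓ , safeΔ) d
    rest = lab w (eq (f y) (f z)) ∷ map (renE f) Γ
    conclusion-eq : ∀ {E₁ E₂} → E₁ ≡ E₂ → (E₁ ∷ rest ⇒ map (renE f) Δ) ≡ (E₂ ∷ rest ⇒ map (renE f) Δ)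
    conclusion-eq refl = refl
    premiss-eq : ∀ {E₁ E₂ E₃ E₄} → E₁ ≡ E₂ → E₃ ≡ E₄ →
                 (E₂ ∷ E₄ ∷ rest ⇒ map (renE f) Δ) ≡ (E₁ ∷ E₃ ∷ rest ⇒ map (renE f) Δ)
    premiss-eq refl refl = refl

  -- one rule application, transported along a safe renaming f; in the
  -- patterns, k is the safety of the principal expression and kΓ, kΔ
  -- that of the contexts
  renameInference : ∀ {N m ps c} f → Rule N ps c → All (Deriv N m) ps → Safe f c → RenamingIH N m →
                    Inference N m (renS f c)
  renameInference f (init-at at) [] _ _ = infer (init-at (IsAtomic-renF f at)) []
  renameInference f init-D [] _ _ = infer init-D []
  renameInference f init-⊥ [] _ _ = infer init-⊥ []
  renameInference f (L∧ {A = A}) (d ∷ []) (k ∷ kΓ , kΔ) ih =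
    infer L∧ (ih f _ (++⁻ˡ (BVF A) k ∷ ++⁻ʳ (BVF A) k ∷ kΓ , kΔ) d ∷ [])
  renameInference f (R∧ {A = A}) (d₁ ∷ d₂ ∷ []) (kΓ , k ∷ kΔ) ih =
    infer R∧ (ih f _ (kΓ , ++⁻ˡ (BVF A) k ∷ kΔ) d₁ ∷ ih f _ (kΓ , ++⁻ʳ (BVF A) k ∷ kΔ) d₂ ∷ [])
  renameInference f (L∨ {A = A}) (d₁ ∷ d₂ ∷ []) (k ∷ kΓ , kΔ) ih =
    infer L∨ (ih f _ (++⁻ˡ (BVF A) k ∷ kΓ , kΔ) d₁ ∷ ih f _ (++⁻ʳ (BVF A) k ∷ kΓ , kΔ) d₂ ∷ [])
  renameInference f (R∨ {A = A}) (d ∷ []) (kΓ , k ∷ kΔ) ih =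
    infer R∨ (ih f _ (kΓ , ++⁻ˡ (BVF A) k ∷ ++⁻ʳ (BVF A) k ∷ kΔ) d ∷ [])
  renameInference f (L⊃ {A = A}) (d₁ ∷ d₂ ∷ []) (k ∷ kΓ , kΔ) ih =
    infer L⊃ (ih f _ (kΓ , ++⁻ˡ (BVF A) k ∷ kΔ) d₁ ∷ ih f _ (++⁻ʳ (BVF A) k ∷ kΓ , kΔ) d₂ ∷ [])
  renameInference f (R⊃ {A = A}) (d ∷ []) (kΓ , k ∷ kΔ) ih =
    infer R⊃ (ih f _ (++⁻ˡ (BVF A) k ∷ kΓ , ++⁻ʳ (BVF A) k ∷ kΔ) d ∷ [])
  renameInference f (L∀ {w} {x} {y} {A}) (d ∷ []) ([] ∷ k@(inj ∷ kA) ∷ kΓ , kΔ) ih =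
    infer L∀ (castˡ (renF-subF f y x inj A) (ih f _ (SafeE-subF f y x w A kA ∷ [] ∷ k ∷ kΓ , kΔ) d) ∷ [])
  renameInference f (R∀ {w} {x} {z} {A} {Γ} {Δ} z∉) (d ∷ []) safe ih = rename-R∀ f w x z A Γ Δ z∉ safe ih d
  renameInference f (L∃ {w} {x} {z} {A} {Γ} {Δ} z∉) (d ∷ []) safe ih = rename-L∃ f w x z A Γ Δ z∉ safe ih d
  renameInference f (R∃ {w} {x} {y} {A}) (d ∷ []) ([] ∷ kΓ , k@(inj ∷ kA) ∷ kΔ) ih =
    infer R∃ (castʳ₂ (renF-subF f y x inj A) (ih f _ ([] ∷ kΓ , k ∷ SafeE-subF f y x w A kA ∷ kΔ) d) ∷ [])
  renameInference f L□ (d ∷ []) ([] ∷ k ∷ kΓ , kΔ) ih = infer L□ (ih f _ (k ∷ [] ∷ k ∷ kΓ , kΔ) d ∷ [])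
  renameInference f (R□ {w} {u} {A} {Γ} {Δ} u∉) (d ∷ []) (kΓ , k ∷ kΔ) ih =
    infer (R□ (FreshLabel-renS f u (Γ ⇒ lab w (□' A) ∷ Δ) u∉)) (ih f _ ([] ∷ kΓ , k ∷ kΔ) d ∷ [])
  renameInference f (L◇ {w} {u} {A} {Γ} {Δ} u∉) (d ∷ []) (k ∷ kΓ , kΔ) ih =
    infer (L◇ (FreshLabel-renS f u (lab w (◇' A) ∷ Γ ⇒ Δ) u∉)) (ih f _ ([] ∷ k ∷ kΓ , kΔ) d ∷ [])
  renameInference f R◇ (d ∷ []) ([] ∷ kΓ , k ∷ kΔ) ih = infer R◇ (ih f _ ([] ∷ kΓ , k ∷ k ∷ kΔ) d ∷ [])
  renameInference f Ref= (d ∷ []) (kΓ , kΔ) ih = infer Ref= (ih f _ ([] ∷ kΓ , kΔ) d ∷ [])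
  renameInference f RigVar (d ∷ []) ([] ∷ kΓ , kΔ) ih = infer RigVar (ih f _ ([] ∷ [] ∷ kΓ , kΔ) d ∷ [])
  renameInference f (Repl-D {w} {a} {b} {x} {y} {z} {Γ} {Δ}) (d ∷ []) (_ ∷ _ ∷ kΓ , kΔ) ih =
    rename-Repl f (den-target {a} {b} {w}) x y z Γ Δ kΓ kΔ ih d
  renameInference f (Repl-dom {w} {a} {x} {y} {z} {Γ} {Δ}) (d ∷ []) (_ ∷ _ ∷ kΓ , kΔ) ih =
    rename-Repl f (dom-target {a} {w}) x y z Γ Δ kΓ kΔ ih d
  renameInference f (Repl-at {x = x} {y} {z} {Γ} {Δ} at) (d ∷ []) (_ ∷ _ ∷ kΓ , kΔ) ih =
    rename-Repl f (atom-target at) x y z Γ Δ kΓ kΔ ih d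
  renameInference f (Lλ {w} {x} {z} {B} {t} {Γ} {Δ} z∉) (d ∷ []) safe ih = rename-Lλ f w x z B t Γ Δ z∉ safe ih d
  renameInference f (Rλ {w} {x} {y} {B}) (d₁ ∷ d₂ ∷ []) (kΓ , k@(inj ∷ kBt) ∷ kΔ) ih =
    infer Rλ (ih f _ (kΓ , k ∷ ++⁻ʳ (BVF B) kBt ∷ kΔ) d₁
      ∷ castʳ₂ (renF-subF f y x inj B) (ih f _ (kΓ , k ∷ SafeE-subF f y x w B (++⁻ˡ (BVF B) kBt) ∷ kΔ) d₂) ∷ [])
  renameInference f (LD₁ {w} {x₁} {x₂} {A}) (d ∷ []) (k@(inj ∷ kA) ∷ kΓ , kΔ) ih =
    infer LD₁ (castˡ (renF-subF f x₂ x₁ inj A) (ih f _ (SafeE-subF f x₂ x₁ w A kA ∷ k ∷ kΓ , kΔ) d) ∷ [])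
  renameInference f (LD₂ {w} {x₁} {x₂} {y} {A}) (d₁ ∷ d₂ ∷ []) (k@(inj ∷ kA) ∷ kΓ , kΔ) ih =
    infer LD₂ (castʳ (renF-subF f y x₁ inj A) (ih f _ (k ∷ kΓ , SafeE-subF f y x₁ w A kA ∷ kΔ) d₁)
      ∷ ih f _ ([] ∷ k ∷ kΓ , kΔ) d₂ ∷ [])
  renameInference f (RD {w} {x₁} {x₂} {z} {A} {Γ} {Δ} z∉) (d₁ ∷ d₂ ∷ []) safe ih =
    rename-RD f w x₁ x₂ z A Γ Δ z∉ safe ih d₁ d₂
  renameInference f DenVar (d ∷ []) (kΓ , kΔ) ih = infer DenVar (ih f _ ([] ∷ kΓ , kΔ) d ∷ [])
  renameInference f DenId (d ∷ []) ([] ∷ kΓ , kΔ) ih = infer DenId (ih f _ ([] ∷ [] ∷ kΓ , kΔ) d ∷ [])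
  renameInference f (Ref-W n) (d ∷ []) (kΓ , kΔ) ih = infer (Ref-W n) (ih f _ ([] ∷ kΓ , kΔ) d ∷ [])
  renameInference f (Ser {u = u} {Γ} {Δ} n u∉) (d ∷ []) (kΓ , kΔ) ih =
    infer (Ser n (FreshLabel-renS f u (Γ ⇒ Δ) u∉)) (ih f _ ([] ∷ kΓ , kΔ) d ∷ [])
  renameInference f (Trans n) (d ∷ []) ([] ∷ [] ∷ kΓ , kΔ) ih = infer (Trans n) (ih f _ ([] ∷ [] ∷ [] ∷ kΓ , kΔ) d ∷ [])
  renameInference f (Eucl n) (d ∷ []) ([] ∷ [] ∷ kΓ , kΔ) ih = infer (Eucl n) (ih f _ ([] ∷ [] ∷ [] ∷ kΓ , kΔ) d ∷ [])
  renameInference f (Euclᶜ n) (d ∷ []) ([] ∷ kΓ , kΔ) ih = infer (Euclᶜ n) (ih f _ ([] ∷ [] ∷ kΓ , kΔ) d ∷ [])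
  renameInference f (Incr n) (d ∷ []) ([] ∷ [] ∷ kΓ , kΔ) ih = infer (Incr n) (ih f _ ([] ∷ [] ∷ [] ∷ kΓ , kΔ) d ∷ [])
  renameInference f (Decr n) (d ∷ []) ([] ∷ [] ∷ kΓ , kΔ) ih = infer (Decr n) (ih f _ ([] ∷ [] ∷ [] ∷ kΓ , kΔ) d ∷ [])
  renameInference f (Cons n) (d ∷ []) (kΓ , kΔ) ih = infer (Cons n) (ih f _ ([] ∷ kΓ , kΔ) d ∷ [])

  renameDeriv : ∀ {N} m f s → Safe f s → Deriv N m s → Deriv N m (renS f s)
  renameDeriv zero f s safe ()
  renameDeriv (suc m) f s safe (node r perm good ds) =
    node rule (≈ₛ-renS f perm) (GoodSeq-renS f s safe good) derivs
    where open Inference (renameInference f r ds (Safe-↭ f perm safe) (renameDeriv m))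

  FVList-relabel : ∀ h L → concatMap FVE (map (relabelE h) L) ≡ concatMap (FVE {S}) L
  FVList-relabel h [] = refl
  FVList-relabel h (lab w A ∷ L) = cong (FVF A ++_) (FVList-relabel h L)
  FVList-relabel h (dom z w ∷ L) = cong (z ∷_) (FVList-relabel h L)
  FVList-relabel h (rel w v ∷ L) = FVList-relabel h L
  FVList-relabel h (den t z w ∷ L) = cong ((FVT t ++ z ∷ []) ++_) (FVList-relabel h L)

  BVList-relabel : ∀ h L → concatMap BVE (map (relabelE h) L) ≡ concatMap (BVE {S}) L
  BVList-relabel h [] = refl
  BVList-relabel h (lab w A ∷ L) = cong (BVF A ++_) (BVList-relabel h L)
  BVList-relabel h (dom z w ∷ L) = BVList-relabel h L
  BVList-relabel h (rel w v ∷ L) = BVList-relabel h L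
  BVList-relabel h (den t z w ∷ L) = cong (BVT t ++_) (BVList-relabel h L)

  FVs-relabel : ∀ h s → FVs (relabelS h s) ≡ FVs s
  FVs-relabel h (Γ ⇒ Δ) = cong₂ _++_ (FVList-relabel h Γ) (FVList-relabel h Δ)

  BVs-relabel : ∀ h s → BVs (relabelS h s) ≡ BVs s
  BVs-relabel h (Γ ⇒ Δ) = cong₂ _++_ (BVList-relabel h Γ) (BVList-relabel h Δ)

  FreshVar-relabel : ∀ h z s → FreshVar z s → FreshVar z (relabelS h s)
  FreshVar-relabel h z s = subst (z ∉_) (sym (cong₂ _++_ (FVs-relabel h s) (BVs-relabel h s)))

  SuccOK-relabel : ∀ h Δ → All SuccOK Δ → All (SuccOK {S}) (map (relabelE h) Δ)
  SuccOK-relabel h [] [] = []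
  SuccOK-relabel h (lab w A ∷ Δ) (_ ∷ oks) = tt ∷ SuccOK-relabel h Δ oks
  SuccOK-relabel h (den t z w ∷ Δ) (_ ∷ oks) = tt ∷ SuccOK-relabel h Δ oks

  GoodSeq-relabel : ∀ h s → GoodSeq s → GoodSeq (relabelS h s)
  GoodSeq-relabel h s@(Γ ⇒ Δ) (pure , oks) =
    (λ v i j → pure v (subst (v ∈_) (FVs-relabel h s) i) (subst (v ∈_) (BVs-relabel h s) j)) ,
    SuccOK-relabel h Δ oks

  ≈ₛ-relabel : ∀ h {s s'} → s ≈ₛ s' → relabelS h s ≈ₛ relabelS h s'
  ≈ₛ-relabel h {_ ⇒ _} {_ ⇒ _} (Γ↭ , Δ↭) = ↭-map⁺ (relabelE h) Γ↭ , ↭-map⁺ (relabelE h) Δ↭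

  relabelE-update : ∀ h u U E → u ∉ LabE E → relabelE (h [ u ↦ U ]) E ≡ relabelE h E
  relabelE-update h u U (lab w A) u∉ = cong (λ v → lab v A) (update-there h u U (λ e → u∉ (here (sym e))))
  relabelE-update h u U (dom z w) u∉ = cong (dom z) (update-there h u U (λ e → u∉ (here (sym e))))
  relabelE-update h u U (rel w v) u∉ =
    cong₂ rel (update-there h u U (λ e → u∉ (here (sym e)))) (update-there h u U (λ e → u∉ (there (here (sym e)))))
  relabelE-update h u U (den t z w) u∉ = cong (den t z) (update-there h u U (λ e → u∉ (here (sym e))))

  relabelList-update : ∀ h u U L → u ∉ concatMap LabE L → map (relabelE (h [ u ↦ U ])) L ≡ map (relabelE h) L
  relabelList-update h u U [] _ = refl
  relabelList-update h u U (E ∷ L) u∉ =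
    cong₂ _∷_ (relabelE-update h u U E (∉-++ˡ (LabE E) u∉)) (relabelList-update h u U L (∉-++ʳ (LabE E) u∉))

  RelabellingIH : (NL → Bool) → ℕ → Set
  RelabellingIH N m = ∀ g s → Deriv N m s → Deriv N m (relabelS g s)

  eigenLabel : (Label → Label) → Seq S → Label
  eigenLabel h c = fresh (Labels (relabelS h c))

  relabel-R□ : ∀ {N m} h w u A Γ Δ → FreshLabel u (Γ ⇒ lab w (□' A) ∷ Δ) → RelabellingIH N m →
    Deriv N m (rel w u ∷ Γ ⇒ lab u A ∷ Δ) → Inference N m (relabelS h (Γ ⇒ lab w (□' A) ∷ Δ))
  relabel-R□ h w u A Γ Δ u∉ ih d = infer (R□ (fresh-∉ _)) (subst (Deriv _ _) premiss (ih (h [ u ↦ U ]) _ d) ∷ [])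
    where
    U = eigenLabel h (Γ ⇒ lab w (□' A) ∷ Δ)
    u∉Γ = ∉-++ˡ (concatMap LabE Γ) u∉
    u∉wΔ = ∉-++ʳ (concatMap LabE Γ) u∉
    premiss = cong₂ _⇒_
      (cong₂ _∷_ (cong₂ rel (update-there h u U (λ e → u∉wΔ (here (sym e)))) (update-here h u U))
                 (relabelList-update h u U Γ u∉Γ))
      (cong₂ _∷_ (cong (λ v → lab v A) (update-here h u U)) (relabelList-update h u U Δ (λ i → u∉wΔ (there i))))

  relabel-L◇ : ∀ {N m} h w u A Γ Δ → FreshLabel u (lab w (◇' A) ∷ Γ ⇒ Δ) → RelabellingIH N m →
    Deriv N m (rel w u ∷ lab u A ∷ Γ ⇒ Δ) → Inference N m (relabelS h (lab w (◇' A) ∷ Γ ⇒ Δ))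
  relabel-L◇ h w u A Γ Δ u∉ ih d = infer (L◇ (fresh-∉ _)) (subst (Deriv _ _) premiss (ih (h [ u ↦ U ]) _ d) ∷ [])
    where
    U = eigenLabel h (lab w (◇' A) ∷ Γ ⇒ Δ)
    u∉wΓ = ∉-++ˡ (concatMap LabE (lab w (◇' A) ∷ Γ)) u∉
    u∉Δ = ∉-++ʳ (concatMap LabE (lab w (◇' A) ∷ Γ)) u∉
    premiss = cong₂ _⇒_
      (cong₂ _∷_ (cong₂ rel (update-there h u U (λ e → u∉wΓ (here (sym e)))) (update-here h u U))
        (cong₂ _∷_ (cong (λ v → lab v A) (update-here h u U)) (relabelList-update h u U Γ (λ i → u∉wΓ (there i)))))
      (relabelList-update h u U Δ u∉Δ)

  relabel-Ser : ∀ {N m} h w u Γ Δ → T (N ser) → FreshLabel u (Γ ⇒ Δ) → RelabellingIH N m →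
    Deriv N m (rel w u ∷ Γ ⇒ Δ) → Inference N m (relabelS h (Γ ⇒ Δ))
  relabel-Ser h w u Γ Δ n u∉ ih d = infer (Ser n (fresh-∉ _)) (subst (Deriv _ _) premiss (ih (h [ u ↦ U ]) _ d) ∷ [])
    where
    U = eigenLabel h (Γ ⇒ Δ)
    premiss = cong₂ _⇒_
      (cong₂ _∷_ (cong (rel ((h [ u ↦ U ]) w)) (update-here h u U))
                 (relabelList-update h u U Γ (∉-++ˡ (concatMap LabE Γ) u∉)))
      (relabelList-update h u U Δ (∉-++ʳ (concatMap LabE Γ) u∉))

  relabelInference : ∀ {N m ps c} h → Rule N ps c → All (Deriv N m) ps → RelabellingIH N m →
                     Inference N m (relabelS h c)
  relabelInference h (init-at at) [] _ = infer (init-at at) []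
  relabelInference h init-D [] _ = infer init-D []
  relabelInference h init-⊥ [] _ = infer init-⊥ []
  relabelInference h L∧ (d ∷ []) ih = infer L∧ (ih h _ d ∷ [])
  relabelInference h R∧ (d₁ ∷ d₂ ∷ []) ih = infer R∧ (ih h _ d₁ ∷ ih h _ d₂ ∷ [])
  relabelInference h L∨ (d₁ ∷ d₂ ∷ []) ih = infer L∨ (ih h _ d₁ ∷ ih h _ d₂ ∷ [])
  relabelInference h R∨ (d ∷ []) ih = infer R∨ (ih h _ d ∷ [])
  relabelInference h L⊃ (d₁ ∷ d₂ ∷ []) ih = infer L⊃ (ih h _ d₁ ∷ ih h _ d₂ ∷ [])
  relabelInference h R⊃ (d ∷ []) ih = infer R⊃ (ih h _ d ∷ [])
  relabelInference h L∀ (d ∷ []) ih = infer L∀ (ih h _ d ∷ [])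
  relabelInference h (R∀ {w} {x} {z} {A} {Γ} {Δ} z∉) (d ∷ []) ih =
    infer (R∀ (FreshVar-relabel h z (Γ ⇒ lab w (∀' x A) ∷ Δ) z∉)) (ih h _ d ∷ [])
  relabelInference h (L∃ {w} {x} {z} {A} {Γ} {Δ} z∉) (d ∷ []) ih =
    infer (L∃ (FreshVar-relabel h z (lab w (∃' x A) ∷ Γ ⇒ Δ) z∉)) (ih h _ d ∷ [])
  relabelInference h R∃ (d ∷ []) ih = infer R∃ (ih h _ d ∷ [])
  relabelInference h L□ (d ∷ []) ih = infer L□ (ih h _ d ∷ [])
  relabelInference h (R□ {w} {u} {A} {Γ} {Δ} u∉) (d ∷ []) ih = relabel-R□ h w u A Γ Δ u∉ ih d
  relabelInference h (L◇ {w} {u} {A} {Γ} {Δ} u∉) (d ∷ []) ih = relabel-L◇ h w u A Γ Δ u∉ ih d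
  relabelInference h R◇ (d ∷ []) ih = infer R◇ (ih h _ d ∷ [])
  relabelInference h Ref= (d ∷ []) ih = infer Ref= (ih h _ d ∷ [])
  relabelInference h RigVar (d ∷ []) ih = infer RigVar (ih h _ d ∷ [])
  relabelInference h (Repl-D {w} {a} {b} {x} {y} {z} {Γ} {Δ}) (d ∷ []) ih =
    infer (Repl-D {w = h w} {a} {b} {x} {y} {z} {map (relabelE h) Γ} {map (relabelE h) Δ}) (ih h _ d ∷ [])
  relabelInference h (Repl-dom {w} {a} {x} {y} {z} {Γ} {Δ}) (d ∷ []) ih =
    infer (Repl-dom {w = h w} {a} {x} {y} {z} {map (relabelE h) Γ} {map (relabelE h) Δ}) (ih h _ d ∷ [])
  relabelInference h (Repl-at {w} {p} {x} {y} {z} {Γ} {Δ} at) (d ∷ []) ih =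
    infer (Repl-at {w = h w} {p} {x} {y} {z} {map (relabelE h) Γ} {map (relabelE h) Δ} at) (ih h _ d ∷ [])
  relabelInference h (Lλ {w} {x} {z} {B} {t} {Γ} {Δ} z∉) (d ∷ []) ih =
    infer (Lλ (FreshVar-relabel h z (lab w (lam x B t) ∷ Γ ⇒ Δ) z∉)) (ih h _ d ∷ [])
  relabelInference h Rλ (d₁ ∷ d₂ ∷ []) ih = infer Rλ (ih h _ d₁ ∷ ih h _ d₂ ∷ [])
  relabelInference h LD₁ (d ∷ []) ih = infer LD₁ (ih h _ d ∷ [])
  relabelInference h LD₂ (d₁ ∷ d₂ ∷ []) ih = infer LD₂ (ih h _ d₁ ∷ ih h _ d₂ ∷ [])
  relabelInference h (RD {w} {x₁} {x₂} {z} {A} {Γ} {Δ} z∉) (d₁ ∷ d₂ ∷ []) ih =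
    infer (RD (FreshVar-relabel h z (Γ ⇒ den (ι x₁ A) x₂ w ∷ Δ) z∉)) (ih h _ d₁ ∷ ih h _ d₂ ∷ [])
  relabelInference h DenVar (d ∷ []) ih = infer DenVar (ih h _ d ∷ [])
  relabelInference h DenId (d ∷ []) ih = infer DenId (ih h _ d ∷ [])
  relabelInference h (Ref-W n) (d ∷ []) ih = infer (Ref-W n) (ih h _ d ∷ [])
  relabelInference h (Ser {w} {u} {Γ} {Δ} n u∉) (d ∷ []) ih = relabel-Ser h w u Γ Δ n u∉ ih d
  relabelInference h (Trans n) (d ∷ []) ih = infer (Trans n) (ih h _ d ∷ [])
  relabelInference h (Eucl n) (d ∷ []) ih = infer (Eucl n) (ih h _ d ∷ [])
  relabelInference h (Euclᶜ n) (d ∷ []) ih = infer (Euclᶜ n) (ih h _ d ∷ [])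
  relabelInference h (Incr n) (d ∷ []) ih = infer (Incr n) (ih h _ d ∷ [])
  relabelInference h (Decr n) (d ∷ []) ih = infer (Decr n) (ih h _ d ∷ [])
  relabelInference h (Cons n) (d ∷ []) ih = infer (Cons n) (ih h _ d ∷ [])

  relabelDeriv : ∀ {N} m h s → Deriv N m s → Deriv N m (relabelS h s)
  relabelDeriv zero h s ()
  relabelDeriv (suc m) h s (node r perm good ds) =
    node rule (≈ₛ-relabel h perm) (GoodSeq-relabel h s good) derivs
    where open Inference (relabelInference h r ds (relabelDeriv m))

  subVec-fresh : ∀ y x {n} (xs : Vec Var n) → x ∉ toList xs → Vec.map (subV y x) xs ≡ xs
  subVec-fresh y x v[] _ = refl
  subVec-fresh y x (a v∷ xs) x∉ =
    cong₂ _v∷_ (subV-there y x (λ e → x∉ (here (sym e)))) (subVec-fresh y x xs (λ i → x∉ (there i)))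

  mutual
    subT-fresh : ∀ y x t → x ∉ FVT t → subT {S} y x t ≡ t
    subT-fresh y x (var a) x∉ = cong var (subV-there y x (λ e → x∉ (here (sym e))))
    subT-fresh y x (ι b A) x∉ with ≡ᵇ-cases b x
    ... | inj₁ refl rewrite ≡ᵇ-refl b = refl
    ... | inj₂ (b≢x , e) rewrite e = cong (ι b) (subF-fresh y x A (∉-remove b (FVF A) x∉ (λ q → b≢x (sym q))))

    subF-fresh : ∀ y x A → x ∉ FVF A → subF {S} y x A ≡ A
    subF-fresh y x (pred P xs) x∉ = cong (pred P) (subVec-fresh y x xs x∉)
    subF-fresh y x (eq a b) x∉ =
      cong₂ eq (subV-there y x (λ e → x∉ (here (sym e)))) (subV-there y x (λ e → x∉ (there (here (sym e)))))
    subF-fresh y x ⊥' _ = refl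
    subF-fresh y x (A ∧' B) x∉ = cong₂ _∧'_ (subF-fresh y x A (∉-++ˡ (FVF A) x∉)) (subF-fresh y x B (∉-++ʳ (FVF A) x∉))
    subF-fresh y x (A ∨' B) x∉ = cong₂ _∨'_ (subF-fresh y x A (∉-++ˡ (FVF A) x∉)) (subF-fresh y x B (∉-++ʳ (FVF A) x∉))
    subF-fresh y x (A ⊃' B) x∉ = cong₂ _⊃'_ (subF-fresh y x A (∉-++ˡ (FVF A) x∉)) (subF-fresh y x B (∉-++ʳ (FVF A) x∉))
    subF-fresh y x (∀' b A) x∉ with ≡ᵇ-cases b x
    ... | inj₁ refl rewrite ≡ᵇ-refl b = refl
    ... | inj₂ (b≢x , e) rewrite e = cong (∀' b) (subF-fresh y x A (∉-remove b (FVF A) x∉ (λ q → b≢x (sym q))))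
    subF-fresh y x (∃' b A) x∉ with ≡ᵇ-cases b x
    ... | inj₁ refl rewrite ≡ᵇ-refl b = refl
    ... | inj₂ (b≢x , e) rewrite e = cong (∃' b) (subF-fresh y x A (∉-remove b (FVF A) x∉ (λ q → b≢x (sym q))))
    subF-fresh y x (□' A) x∉ = cong □' (subF-fresh y x A x∉)
    subF-fresh y x (◇' A) x∉ = cong ◇' (subF-fresh y x A x∉)
    subF-fresh y x (lam b A t) x∉ with ≡ᵇ-cases b x
    ... | inj₁ refl rewrite ≡ᵇ-refl b = cong (lam b A) (subT-fresh y b t (∉-++ʳ (removeV b (FVF A)) x∉))
    ... | inj₂ (b≢x , e) rewrite e =
      cong₂ (lam b) (subF-fresh y x A (∉-remove b (FVF A) (∉-++ˡ (removeV b (FVF A)) x∉) (λ q → b≢x (sym q))))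
                    (subT-fresh y x t (∉-++ʳ (removeV b (FVF A)) x∉))

  -- In an α-equivalence
  -- derivation under context ρ, the context pairs the binders of the left
  -- formula with those of the right one; renaming the right formula by f
  -- renames the right components of ρ.  The main result of this module,
  -- substF, says: if A ≈ B, y is free for x in A, f is injective at the
  -- binders of B and acts as [y/x] on the free variables of B, then
  -- A[y/x] ≈ f(B).
  module SubstitutionAlpha (f : Var → Var) (x y : Var) where

    infix 4 _⊢_≈_
    _⊢_≈_ : List (Var × Var) → Var → Var → Set
    _⊢_≈_ = _⊢_≈ᵛ_ {S}

    renameRight : List (Var × Var) → List (Var × Var)
    renameRight [] = []
    renameRight ((a , b) ∷ ρ) = (a , f b) ∷ renameRight ρ

    lefts rights : List (Var × Var) → List Var
    lefts [] = []
    lefts ((a , _) ∷ ρ) = a ∷ lefts ρ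
    rights [] = []
    rights ((_ , b) ∷ ρ) = b ∷ rights ρ

    InjRight : List (Var × Var) → Set
    InjRight ρ = All (InjAt f) (rights ρ)

    ActsAsSubst : List (Var × Var) → Var → Set
    ActsAsSubst ρ b = b ∉ rights ρ → f b ≡ subV y x b

    NotFreeX : List (Var × Var) → Var → Set
    NotFreeX ρ a = a ∉ lefts ρ → a ≢ x

    ActsAsSubst-bind : ∀ {ρ} z z' L → All (ActsAsSubst ρ) (removeV z' L) → All (ActsAsSubst ((z , z') ∷ ρ)) L
    ActsAsSubst-bind z z' L acts = All-tabulate λ {b} b∈L b∉ →
      All-lookup acts (∈-remove⁺ z' L b∈L (λ e → b∉ (here e))) (λ j → b∉ (there j))

    NotFreeX-bind : ∀ {ρ} z z' L → All (NotFreeX ρ) (removeV z L) → All (NotFreeX ((z , z') ∷ ρ)) L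
    NotFreeX-bind z z' L nfx = All-tabulate λ {a} a∈L a∉ →
      All-lookup nfx (∈-remove⁺ z L a∈L (λ e → a∉ (here e))) (λ j → a∉ (there j))

    ≈-cases : ∀ {ρ a b} → ρ ⊢ a ≈ b → InjRight ρ →
              (a ∈ lefts ρ × renameRight ρ ⊢ a ≈ f b) ⊎ (a ≡ b × a ∉ lefts ρ × b ∉ rights ρ)
    ≈-cases free _ = inj₂ (refl , (λ ()) , (λ ()))
    ≈-cases here _ = inj₁ (here refl , here)
    ≈-cases (there a≢ b≢ p) (inj ∷ injs) with ≈-cases p injs
    ... | inj₁ (a∈ , q) = inj₁ (there a∈ , there a≢ (λ e → b≢ (inj _ e)) q)
    ... | inj₂ (refl , a∉ , b∉) =
      inj₂ (refl , (λ { (here e) → a≢ e ; (there i) → a∉ i }) , (λ { (here e) → b≢ e ; (there i) → b∉ i }))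

    ≈-free : ∀ ρ t → t ∉ lefts ρ → (∀ r → r ∈ rights ρ → t ≢ f r) → renameRight ρ ⊢ t ≈ t
    ≈-free [] t _ _ = free
    ≈-free ((l , r) ∷ ρ) t t∉ t≢ =
      there (λ e → t∉ (here e)) (t≢ r (here refl)) (≈-free ρ t (λ i → t∉ (there i)) (λ r' i → t≢ r' (there i)))

    ≈-rename : ∀ {ρ a b} t → ρ ⊢ a ≈ b → InjRight ρ →
               (a ∈ lefts ρ → t ≡ a) → (a ∉ lefts ρ → t ∉ lefts ρ) →
               (a ∉ lefts ρ → b ∉ rights ρ → a ≡ b → f b ≡ t) → renameRight ρ ⊢ t ≈ f b
    ≈-rename {ρ} {a} {b} t p injs bound free-left free-right with ≈-cases p injs
    ... | inj₁ (a∈ , q) = subst (λ u → renameRight ρ ⊢ u ≈ f b) (sym (bound a∈)) q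
    ... | inj₂ (refl , a∉ , b∉) =
      subst (renameRight ρ ⊢ t ≈_) (sym fb≡t) (≈-free ρ t (free-left a∉) t≢image)
      where
      fb≡t = free-right a∉ b∉ refl
      t≢image : ∀ r → r ∈ rights ρ → t ≢ f r
      t≢image r r∈ e = b∉ (subst (_∈ rights ρ) (sym (All-lookup injs r∈ b (≡-trans fb≡t e))) r∈)

    ≈-keep : ∀ {ρ a b} → ρ ⊢ a ≈ b → InjRight ρ → NotFreeX ρ a → ActsAsSubst ρ b → renameRight ρ ⊢ a ≈ f b
    ≈-keep {a = a} p injs a≢x acts =
      ≈-rename a p injs (λ _ → refl) (λ a∉ → a∉)
        (λ { a∉ b∉ refl → ≡-trans (acts b∉) (subV-there y x (a≢x a∉)) })

    ≈-subst : ∀ {ρ a b} → ρ ⊢ a ≈ b → InjRight ρ → x ∉ lefts ρ → y ∉ lefts ρ → ActsAsSubst ρ b →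
              renameRight ρ ⊢ subV y x a ≈ f b
    ≈-subst {ρ} {a} p injs x∉ y∉ acts =
      ≈-rename (subV y x a) p injs bound free-left (λ { _ b∉ refl → acts b∉ })
      where
      bound : a ∈ lefts ρ → subV y x a ≡ a
      bound a∈ = subV-there y x (λ e → x∉ (subst (_∈ lefts ρ) e a∈))
      free-left : a ∉ lefts ρ → subV y x a ∉ lefts ρ
      free-left a∉ with ≡ᵇ-cases a x
      ... | inj₁ refl = subst (_∉ lefts ρ) (sym (subV-here y a)) y∉
      ... | inj₂ (a≢x , _) = subst (_∉ lefts ρ) (sym (subV-there y x a≢x)) a∉

    keepVec : ∀ {ρ n} {xs ys : Vec Var n} → VP.Pointwise (ρ ⊢_≈_) xs ys → InjRight ρ →
              All (NotFreeX ρ) (toList xs) → All (ActsAsSubst ρ) (toList ys) →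
              VP.Pointwise (renameRight ρ ⊢_≈_) xs (Vec.map f ys)
    keepVec VP.[] _ _ _ = VP.[]
    keepVec (p VP.∷ ps) injs (nfx ∷ nfxs) (acts ∷ actss) = ≈-keep p injs nfx acts VP.∷ keepVec ps injs nfxs actss

    mutual
      keepT : ∀ {ρ t u} → AlphaT ρ t u → InjRight ρ → All (InjAt f) (BVT u) →
              All (ActsAsSubst ρ) (FVT u) → All (NotFreeX ρ) (FVT t) → AlphaT (renameRight ρ) t (renT f u)
      keepT (var p) injs _ (acts ∷ []) (nfx ∷ []) = var (≈-keep p injs nfx acts)
      keepT (ι {x = z} {z'} {A} {B} p) injs (inj ∷ injB) acts nfx =
        ι (keepF p (inj ∷ injs) injB (ActsAsSubst-bind z z' (FVF B) acts) (NotFreeX-bind z z' (FVF A) nfx))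

      keepF : ∀ {ρ A B} → AlphaF ρ A B → InjRight ρ → All (InjAt f) (BVF B) →
              All (ActsAsSubst ρ) (FVF B) → All (NotFreeX ρ) (FVF A) → AlphaF (renameRight ρ) A (renF f B)
      keepF (pred p) injs _ acts nfx = pred (keepVec p injs nfx acts)
      keepF (eq p q) injs _ (acts₁ ∷ acts₂ ∷ []) (nfx₁ ∷ nfx₂ ∷ []) =
        eq (≈-keep p injs nfx₁ acts₁) (≈-keep q injs nfx₂ acts₂)
      keepF ⊥' _ _ _ _ = ⊥'
      keepF (_∧'_ {A} {_} {A'} p q) injs injB acts nfx =
        keepF p injs (++⁻ˡ (BVF A') injB) (++⁻ˡ (FVF A') acts) (++⁻ˡ (FVF A) nfx)
        ∧' keepF q injs (++⁻ʳ (BVF A') injB) (++⁻ʳ (FVF A') acts) (++⁻ʳ (FVF A) nfx)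
      keepF (_∨'_ {A} {_} {A'} p q) injs injB acts nfx =
        keepF p injs (++⁻ˡ (BVF A') injB) (++⁻ˡ (FVF A') acts) (++⁻ˡ (FVF A) nfx)
        ∨' keepF q injs (++⁻ʳ (BVF A') injB) (++⁻ʳ (FVF A') acts) (++⁻ʳ (FVF A) nfx)
      keepF (_⊃'_ {A} {_} {A'} p q) injs injB acts nfx =
        keepF p injs (++⁻ˡ (BVF A') injB) (++⁻ˡ (FVF A') acts) (++⁻ˡ (FVF A) nfx)
        ⊃' keepF q injs (++⁻ʳ (BVF A') injB) (++⁻ʳ (FVF A') acts) (++⁻ʳ (FVF A) nfx)
      keepF (∀' {x = z} {z'} {A} {B} p) injs (inj ∷ injB) acts nfx =
        ∀' (keepF p (inj ∷ injs) injB (ActsAsSubst-bind z z' (FVF B) acts) (NotFreeX-bind z z' (FVF A) nfx))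
      keepF (∃' {x = z} {z'} {A} {B} p) injs (inj ∷ injB) acts nfx =
        ∃' (keepF p (inj ∷ injs) injB (ActsAsSubst-bind z z' (FVF B) acts) (NotFreeX-bind z z' (FVF A) nfx))
      keepF (□' p) injs injB acts nfx = □' (keepF p injs injB acts nfx)
      keepF (◇' p) injs injB acts nfx = ◇' (keepF p injs injB acts nfx)
      keepF (lam {x = z} {z'} {A} {B} p q) injs (inj ∷ injBu) acts nfx =
        lam (keepF p (inj ∷ injs) (++⁻ˡ (BVF B) injBu)
               (ActsAsSubst-bind z z' (FVF B) (++⁻ˡ (removeV z' (FVF B)) acts))
               (NotFreeX-bind z z' (FVF A) (++⁻ˡ (removeV z (FVF A)) nfx)))
            (keepT q injs (++⁻ʳ (BVF B) injBu) (++⁻ʳ (removeV z' (FVF B)) acts) (++⁻ʳ (removeV z (FVF A)) nfx))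

    substVec : ∀ {ρ n} {xs ys : Vec Var n} → VP.Pointwise (ρ ⊢_≈_) xs ys → InjRight ρ →
               x ∉ lefts ρ → y ∉ lefts ρ → All (ActsAsSubst ρ) (toList ys) →
               VP.Pointwise (renameRight ρ ⊢_≈_) (Vec.map (subV y x) xs) (Vec.map f ys)
    substVec VP.[] _ _ _ _ = VP.[]
    substVec (p VP.∷ ps) injs x∉ y∉ (acts ∷ actss) = ≈-subst p injs x∉ y∉ acts VP.∷ substVec ps injs x∉ y∉ actss

    mutual
      substBinder : ∀ {ρ z z' A B} → AlphaF ((z , z') ∷ ρ) A B → (x ∉ removeV z (FVF A)) ⊎ (z ≢ y × FreeForF y x A) →
                    x ∉ lefts ρ → y ∉ lefts ρ → InjRight ρ → InjAt f z' → All (InjAt f) (BVF B) →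
                    All (ActsAsSubst ρ) (removeV z' (FVF B)) →
                    AlphaF ((z , f z') ∷ renameRight ρ) (if z ≡ᵇ x then A else subF y x A) (renF f B)
      substBinder {z = z} {z'} {A} {B} p freeFor x∉ y∉ injs inj injB acts with ≡ᵇ-cases z x
      ... | inj₁ refl rewrite ≡ᵇ-refl z =
        keepF p (inj ∷ injs) injB (ActsAsSubst-bind z z' (FVF B) acts) (All-tabulate (λ _ a∉ e → a∉ (here e)))
      ... | inj₂ (z≢x , e) rewrite e = bodyCase freeFor
        where
        bodyCase : (x ∉ removeV z (FVF A)) ⊎ (z ≢ y × FreeForF y x A) →
                   AlphaF ((z , f z') ∷ renameRight _) (subF y x A) (renF f B)
        bodyCase (inj₁ x∉A) =
          subst (λ C → AlphaF _ C (renF f B)) (sym (subF-fresh y x A x∉FA))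
            (keepF p (inj ∷ injs) injB (ActsAsSubst-bind z z' (FVF B) acts)
              (All-tabulate (λ a∈ _ a≡x → x∉FA (subst (_∈ FVF A) a≡x a∈))))
          where
          x∉FA : x ∉ FVF A
          x∉FA = ∉-remove z (FVF A) x∉A (λ q → z≢x (sym q))
        bodyCase (inj₂ (z≢y , freeFor')) =
          substF p freeFor' (λ { (here q) → z≢x (sym q) ; (there j) → x∉ j })
            (λ { (here q) → z≢y (sym q) ; (there j) → y∉ j }) (inj ∷ injs) injB (ActsAsSubst-bind z z' (FVF B) acts)

      substT : ∀ {ρ t u} → AlphaT ρ t u → FreeForT y x t → x ∉ lefts ρ → y ∉ lefts ρ → InjRight ρ →
               All (InjAt f) (BVT u) → All (ActsAsSubst ρ) (FVT u) → AlphaT (renameRight ρ) (subT y x t) (renT f u)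
      substT (var p) _ x∉ y∉ injs _ (acts ∷ []) = var (≈-subst p injs x∉ y∉ acts)
      substT {ρ} (ι {x = z} {z'} {A} {B} p) freeFor x∉ y∉ injs (inj ∷ injB) acts =
        subst (λ C → AlphaT (renameRight ρ) C (ι (f z') (renF f B))) (if-float (ι z) (z ≡ᵇ x))
          (ι (substBinder p freeFor x∉ y∉ injs inj injB acts))

      substF : ∀ {ρ A B} → AlphaF ρ A B → FreeForF y x A → x ∉ lefts ρ → y ∉ lefts ρ → InjRight ρ →
               All (InjAt f) (BVF B) → All (ActsAsSubst ρ) (FVF B) → AlphaF (renameRight ρ) (subF y x A) (renF f B)
      substF (pred p) _ x∉ y∉ injs _ acts = pred (substVec p injs x∉ y∉ acts)
      substF (eq p q) _ x∉ y∉ injs _ (acts₁ ∷ acts₂ ∷ []) =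
        eq (≈-subst p injs x∉ y∉ acts₁) (≈-subst q injs x∉ y∉ acts₂)
      substF ⊥' _ _ _ _ _ _ = ⊥'
      substF (_∧'_ {_} {_} {A'} p q) (ff₁ , ff₂) x∉ y∉ injs injB acts =
        substF p ff₁ x∉ y∉ injs (++⁻ˡ (BVF A') injB) (++⁻ˡ (FVF A') acts)
        ∧' substF q ff₂ x∉ y∉ injs (++⁻ʳ (BVF A') injB) (++⁻ʳ (FVF A') acts)
      substF (_∨'_ {_} {_} {A'} p q) (ff₁ , ff₂) x∉ y∉ injs injB acts =
        substF p ff₁ x∉ y∉ injs (++⁻ˡ (BVF A') injB) (++⁻ˡ (FVF A') acts)
        ∨' substF q ff₂ x∉ y∉ injs (++⁻ʳ (BVF A') injB) (++⁻ʳ (FVF A') acts)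
      substF (_⊃'_ {_} {_} {A'} p q) (ff₁ , ff₂) x∉ y∉ injs injB acts =
        substF p ff₁ x∉ y∉ injs (++⁻ˡ (BVF A') injB) (++⁻ˡ (FVF A') acts)
        ⊃' substF q ff₂ x∉ y∉ injs (++⁻ʳ (BVF A') injB) (++⁻ʳ (FVF A') acts)
      substF {ρ} (∀' {x = z} {z'} {A} {B} p) freeFor x∉ y∉ injs (inj ∷ injB) acts =
        subst (λ C → AlphaF (renameRight ρ) C (∀' (f z') (renF f B))) (if-float (∀' z) (z ≡ᵇ x))
          (∀' (substBinder p freeFor x∉ y∉ injs inj injB acts))
      substF {ρ} (∃' {x = z} {z'} {A} {B} p) freeFor x∉ y∉ injs (inj ∷ injB) acts =
        subst (λ C → AlphaF (renameRight ρ) C (∃' (f z') (renF f B))) (if-float (∃' z) (z ≡ᵇ x))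
          (∃' (substBinder p freeFor x∉ y∉ injs inj injB acts))
      substF (□' p) freeFor x∉ y∉ injs injB acts = □' (substF p freeFor x∉ y∉ injs injB acts)
      substF (◇' p) freeFor x∉ y∉ injs injB acts = ◇' (substF p freeFor x∉ y∉ injs injB acts)
      substF (lam {x = z} {z'} {A} {B} p q) (ff₁ , ff₂) x∉ y∉ injs (inj ∷ injBu) acts =
        lam (substBinder p ff₁ x∉ y∉ injs inj (++⁻ˡ (BVF B) injBu) (++⁻ˡ (removeV z' (FVF B)) acts))
            (substT q ff₂ x∉ y∉ injs (++⁻ʳ (BVF B) injBu) (++⁻ʳ (removeV z' (FVF B)) acts))

    substE : ∀ {E E'} → AlphaE E E' → FreeForE y x E → SafeE f E' →
             All (ActsAsSubst []) (FVE E') → AlphaE (subE y x E) (renE f E')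
    substE (lab p) freeFor injB acts = lab (substF p freeFor (λ ()) (λ ()) [] injB acts)
    substE (dom {x = z} {w}) _ _ (acts ∷ []) = subst (λ u → AlphaE (dom (subV y x z) w) (dom u w)) (sym (acts (λ ()))) dom
    substE rel _ _ _ = rel
    substE (den {t = t} {u} {z} {w} p) freeFor injB acts =
      subst (λ v → AlphaE (den (subT y x t) (subV y x z) w) (den (renT f u) v w)) (sym (All-head (++⁻ʳ (FVT u) acts) (λ ())))
        (den (substT p freeFor (λ ()) (λ ()) [] injB (++⁻ˡ (FVT u) acts)))

    substList : ∀ {Γ Γ'} → Pointwise AlphaE Γ Γ' → All (FreeForE y x) Γ → All (SafeE f) Γ' →
                All (ActsAsSubst []) (concatMap FVE Γ') → Pointwise AlphaE (map (subE y x) Γ) (map (renE f) Γ')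
    substList [] [] [] _ = []
    substList (_∷_ {y = E'} p ps) (freeFor ∷ freeFors) (safe ∷ safes) acts =
      substE p freeFor safe (++⁻ˡ (FVE E') acts) ∷ substList ps freeFors safes (++⁻ʳ (FVE E') acts)

  -- The renaming realising [y/x] on a derivation whose bound variables
  -- are among B and whose variables and y lie below K: bound variables
  -- are moved to K + v, the other variables below K are substituted, and
  -- the remaining ones are moved beyond reach of the bound ones.
  substRenaming : List Var → ℕ → Var → Var → Var → Var
  substRenaming B K x y v with v ∈? B
  ... | yes _ = K + v
  ... | no _ with v <? K
  ... | yes _ = subV y x v
  ... | no _ = K + K + v

  module _ (B : List Var) (K : ℕ) (x y : Var) where
    private
      f = substRenaming B K x y

    substRenaming-free : ∀ {v} → v ∉ B → v < K → f v ≡ subV y x v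
    substRenaming-free {v} v∉B v<K with v ∈? B
    ... | yes v∈B = ⊥-elim (v∉B v∈B)
    ... | no _ with v <? K
    ... | yes _ = refl
    ... | no v≮K = ⊥-elim (v≮K v<K)

    subV-< : ∀ {v} → v < K → y < K → subV y x v < K
    subV-< {v} v<K y<K with ≡ᵇ-cases v x
    ... | inj₁ refl rewrite subV-here y v = y<K
    ... | inj₂ (v≢x , _) rewrite subV-there y x v≢x = v<K

    substRenaming-injAt : (∀ {b} → b ∈ B → b < K) → y < K → ∀ {b} → b ∈ B → InjAt f b
    substRenaming-injAt B<K y<K {b} b∈B v fv≡fb = injective v (≡-trans fv≡fb bound-value)
      where
      bound-value : f b ≡ K + b
      bound-value with b ∈? B
      ... | yes _ = refl
      ... | no b∉B = ⊥-elim (b∉B b∈B)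
      injective : ∀ v → f v ≡ K + b → v ≡ b
      injective v e with v ∈? B
      ... | yes _ = +-cancelˡ-≡ K v b e
      ... | no _ with v <? K
      ... | yes v<K = ⊥-elim (<⇒≢ (<-≤-trans (subV-< v<K y<K) (m≤m+n K b)) e)
      ... | no _ = ⊥-elim (<⇒≢ (<-≤-trans (B<K b∈B) (m≤m+n K v))
                     (sym (+-cancelˡ-≡ K (K + v) b (≡-trans (sym (+-assoc K K v)) e))))

  Deriv-pure : ∀ {N n} {s : Seq S} → Deriv N n s → Pure s
  Deriv-pure {s = _ ⇒ _} (node _ _ (pure , _) _) = pure

  substitution-admissible : ∀ {N} n (Γ Δ : List (Expr S)) x y → All (FreeForE y x) Γ → All (FreeForE y x) Δ →
    DerivableH N n (Γ ⇒ Δ) → DerivableH N n (map (subE y x) Γ ⇒ map (subE y x) Δ)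
  substitution-admissible n Γ Δ x y freeForΓ freeForΔ (s'@(Γ' ⇒ Δ') , (αΓ , αΔ) , d) =
    renS f s' ,
    (substList αΓ freeForΓ (safe Γ' ∈-++⁺ˡ) (acts Γ' ∈-++⁺ˡ) ,
     substList αΔ freeForΔ (safe Δ' (∈-++⁺ʳ _)) (acts Δ' (∈-++⁺ʳ _))) ,
    renameDeriv n f s' (safe Γ' ∈-++⁺ˡ , safe Δ' (∈-++⁺ʳ _)) d
    where
    K = fresh (y ∷ Vars s')
    f = substRenaming (BVs s') K x y
    open SubstitutionAlpha f x y using (ActsAsSubst; substList)
    below : ∀ {v} → v ∈ Vars s' → v < K
    below v∈ = ∈⇒<fresh (y ∷ Vars s') (there v∈)
    safe : ∀ L → (∀ {v} → v ∈ concatMap BVE L → v ∈ BVs s') → All (SafeE f) L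
    safe L ⊆B = All-tabulate λ E∈ → All-tabulate λ b∈ →
      substRenaming-injAt (BVs s') K x y (λ b∈B → below (∈-++⁺ʳ (FVs s') b∈B))
        (∈⇒<fresh (y ∷ Vars s') (here refl)) (⊆B (∈-concatMap-intro BVE L E∈ b∈))
    acts : ∀ L → (∀ {v} → v ∈ concatMap FVE L → v ∈ FVs s') → All (ActsAsSubst []) (concatMap FVE L)
    acts L ⊆F = All-tabulate λ v∈ _ →
      substRenaming-free (BVs s') K x y (Deriv-pure d _ (⊆F v∈)) (below (∈-++⁺ˡ (⊆F v∈)))

  relabelAlpha : ∀ w v {E E'} → AlphaE E E' → AlphaE (lsubE w v E) (relabelE (subL w v) E')
  relabelAlpha w v (lab p) = lab p
  relabelAlpha w v dom = dom
  relabelAlpha w v rel = rel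
  relabelAlpha w v (den p) = den p

  relabelAlphaList : ∀ w v {Γ Γ'} → Pointwise AlphaE Γ Γ' → Pointwise AlphaE (map (lsubE w v) Γ) (map (relabelE (subL w v)) Γ')
  relabelAlphaList w v [] = []
  relabelAlphaList w v (p ∷ ps) = relabelAlpha w v p ∷ relabelAlphaList w v ps

  relabelling-admissible : ∀ {N} n (Γ Δ : List (Expr S)) w v →
    DerivableH N n (Γ ⇒ Δ) → DerivableH N n (map (lsubE w v) Γ ⇒ map (lsubE w v) Δ)
  relabelling-admissible n Γ Δ w v (s'@(_ ⇒ _) , (αΓ , αΔ) , d) =
    relabelS (subL w v) s' , (relabelAlphaList w v αΓ , relabelAlphaList w v αΔ) , relabelDeriv n (subL w v) s' d

mainTheorem9 : (S : Signature) (N : NL → Bool) →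
    (∀ (n : ℕ) (Γ Δ : List (Expr S)) (x y : Var) →
       All (FreeForE y x) Γ → All (FreeForE y x) Δ →
       DerivableH N n (Γ ⇒ Δ) →
       DerivableH N n (map (subE y x) Γ ⇒ map (subE y x) Δ))
    ×
    (∀ (n : ℕ) (Γ Δ : List (Expr S)) (w v : Label) →
       DerivableH N n (Γ ⇒ Δ) →
       DerivableH N n (map (lsubE w v) Γ ⇒ map (lsubE w v) Δ))
mainTheorem9 S N = substitution-admissible {S} {N} , relabelling-admissible {S} {N}
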